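{- For every integer $n\ge 1$, $$(3n-1)\,f^{\sigma_{3n-2}}=2\,f^{\sigma_{3n-1}}\qquad\text{and}\qquad (3n)\,f^{\sigma_{3n-1}}=f^{\sigma_{3n}}+f^{\tau_{3n}},$$ where the shapes $\sigma_{3n-2},\sigma_{3n-1},\sigma_{3n},\tau_{3n}$ are as defined in the context.
   Context: Partitions are identified with their Young diagrams (English notation, left-justified rows). For a skew shape $\lambda/\mu$ with $N$ boxes, $f^{\lambda/\mu}$ denotes the number of standard Young tableaux of shape $\lambda/\mu$, i.e. fillings of the boxes with $1,\dots,N$, each used once, increasing along rows (left to right) and down columns. The shapes (each index equals the number of boxes): - $\sigma_1=(1)$, $\sigma_4=(2,2)$, and for $m\ge 3$, $\sigma_{3m-2}=(m,m,m-1,m-2,\dots,3,2)/(m-2,m-3,\dots,1,0,0)$. - $\sigma_2=(1,1)$, $\sigma_5=(2,2,2)/(1,0,0)$, and for $m\ge 3$, $\sigma_{3m-1}=(m,m,m,m-1,m-2,\dots,3,2)/(m-1,m-2,\dots,1,0,0)$. - $\sigma_3=(1,1,1)$, $\sigma_6=(2,2,2,1)/(1,0,0,0)$, and for $m\ge 3$, $\sigma_{3m}=(m,m,m,m-1,\dots,3,2,1)/(m-1,m-2,\dots,1,0,0,0)$. - $\tau_3=(2,2)/(1,0)$, and for $n\ge 2$, $\tau_{3n}$ is the skew shape $(m,m,m,m-1,m-2,\dots,3)/(m-1,m-2,\dots,1,0)$ with $m=n+1$ (so it has $3n$ boxes; e.g. $\tau_6=(3,3,3)/(2,1,0)$, $\tau_9=(4,4,4,3)/(3,2,1,0)$).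 -}

module Defs where

open import Data.Nat using (ℕ; zero; suc; _+_; _*_; _∸_; _<ᵇ_; _≡ᵇ_)
open import Data.Bool using (Bool; true; false; _∧_; _∨_; not; if_then_else_)
open import Data.List.Base using (List; []; _∷_; _++_; map; length; upTo; concatMap)
open import Data.Nat.ListAction using (sum)
open import Data.Product using (_×_; _,_; proj₁; proj₂)

-- A partition / skew shape is given by lists of row lengths (English
-- notation, rows indexed from 0, columns indexed from 0).
-- λ/μ consists of the cells (i , j) with μ_i ≤ j < λ_i (μ padded with 0s).
Cell : Set
Cell = ℕ × ℕ

record SkewShape : Set where
  constructor _/_
  field
    outer : List ℕ
    inner : List ℕ
open SkewShape public

range : ℕ → ℕ → List ℕ
range a b = map (a +_) (upTo (b ∸ a))

cellsFrom : ℕ → List ℕ → List ℕ → List Cell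
cellsFrom i []       _        = []
cellsFrom i (l ∷ ls) []       = map (i ,_) (range 0 l) ++ cellsFrom (suc i) ls []
cellsFrom i (l ∷ ls) (m ∷ ms) = map (i ,_) (range m l) ++ cellsFrom (suc i) ls ms

cells : SkewShape → List Cell
cells (λs / μs) = cellsFrom 0 λs μs

Filling : Set
Filling = List (Cell × ℕ)

allFillings : List Cell → ℕ → List Filling
allFillings []       N = [] ∷ []
allFillings (c ∷ cs) N =
  concatMap (λ v → map ((c , v) ∷_) (allFillings cs N)) (range 1 (suc N))

allᵇ : {A : Set} → (A → Bool) → List A → Bool
allᵇ p []       = true
allᵇ p (x ∷ xs) = p x ∧ allᵇ p xs

countVal : ℕ → Filling → ℕ
countVal k T = sum (map (λ p → if proj₂ p ≡ᵇ k then 1 else 0) T)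

usesEachOnce : ℕ → Filling → Bool
usesEachOnce N T = allᵇ (λ k → countVal k T ≡ᵇ 1) (range 1 (suc N))

pairOK : Cell × ℕ → Cell × ℕ → Bool
pairOK ((i , j) , v) ((i' , j') , v') =
  (not ((i ≡ᵇ i') ∧ (j <ᵇ j')) ∨ (v <ᵇ v'))
  ∧ (not ((j ≡ᵇ j') ∧ (i <ᵇ i')) ∨ (v <ᵇ v'))

increasing : Filling → Bool
increasing T = allᵇ (λ p → allᵇ (λ q → pairOK p q) T) T

isSYT : ℕ → Filling → Bool
isSYT N T = usesEachOnce N T ∧ increasing T

f : SkewShape → ℕ
f s = sum (map (λ T → if isSYT N T then 1 else 0) (allFillings cs N))
  where
  cs = cells s
  N  = length cs

-- [a , a-1 , … , b]  (inclusive; empty if a < b)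
dec : ℕ → ℕ → List ℕ
dec a b = map (a ∸_) (upTo (suc a ∸ b))

-- σA m = σ_{3m-2}, σB m = σ_{3m-1}, σC m = σ_{3m}, τ n = τ_{3n}  (m , n ≥ 1)
σA : ℕ → SkewShape
σA 0 = [] / []
σA 1 = (1 ∷ []) / []
σA 2 = (2 ∷ 2 ∷ []) / []
σA m@(suc (suc (suc _))) = (m ∷ dec m 2) / (dec (m ∸ 2) 0 ++ (0 ∷ []))

σB : ℕ → SkewShape
σB 0 = [] / []
σB 1 = (1 ∷ 1 ∷ []) / []
σB 2 = (2 ∷ 2 ∷ 2 ∷ []) / (1 ∷ 0 ∷ 0 ∷ [])
σB m@(suc (suc (suc _))) = (m ∷ m ∷ dec m 2) / (dec (m ∸ 1) 0 ++ (0 ∷ []))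

σC : ℕ → SkewShape
σC 0 = [] / []
σC 1 = (1 ∷ 1 ∷ 1 ∷ []) / []
σC 2 = (2 ∷ 2 ∷ 2 ∷ 1 ∷ []) / (1 ∷ 0 ∷ 0 ∷ 0 ∷ [])
σC m@(suc (suc (suc _))) = (m ∷ m ∷ dec m 1) / (dec (m ∸ 1) 0 ++ (0 ∷ 0 ∷ []))

τ : ℕ → SkewShape
τ 0 = [] / []
τ 1 = (2 ∷ 2 ∷ []) / (1 ∷ 0 ∷ [])
τ n@(suc (suc _)) = (m ∷ m ∷ dec m 3) / dec (m ∸ 1) 0
  where m = suc n

-- Write N for the number of cells of σ_{3m-2} (so N + 1 = 3m - 1) and K = m - 1. The shape σ_{3m-1} is
-- σ_{3m-2} moved down one row with a new cell (0, K) on top, whose only successor is the moved corner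
-- (0, K) of σ_{3m-2}. A standard tableau of σ_{3m-1} is therefore a standard tableau T of σ_{3m-2}
-- together with an entry k ≤ T(0, K) for the new cell, the entries ≥ k of T being raised by one; so
-- f^{σ_{3m-1}} = Σ_T T(0, K). Reflecting σ_{3m-2} in its anti-diagonal, (i, j) ↦ (K - j, K - i), reverses
-- its order and fixes (0, K); combined with v ↦ N + 1 - v on entries it gives Σ_T T(0, K) = Σ_T (N + 1 - T(0, K)),
-- whence 2 f^{σ_{3m-1}} = (N + 1) f^{σ_{3m-2}}.
-- In the same way σ_{3m} adds a cell below the bottom cell u = (m, 0) of σ_{3m-1}, and τ_{3m} is σ_{3m-1}
-- moved right with a cell added to the left of u, so that f^{σ_{3m}} = Σ_T (3m - T(u)) and f^{τ_{3m}} = Σ_T T(u)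
-- over the standard tableaux T of σ_{3m-1}; adding gives 3m f^{σ_{3m-1}}.

module Submission where

open import Defs
open import Algebra.Bundles using (CommutativeMonoid)
import Algebra.Properties.CommutativeSemigroup as CommSemigroupProperties
open import Data.Bool using (Bool; true; false; _∧_; _∨_; not; if_then_else_)
open import Data.Bool.Properties using (∧-assoc; ∧-comm; ∨-comm; ∧-zeroʳ; ∨-zeroʳ; ∧-identityʳ; ∨-identityʳ; ∧-commutativeMonoid)
open import Data.Empty using (⊥; ⊥-elim)
open import Data.List.Base using (List; []; _∷_; _++_; map; length; upTo; concatMap; reverse; [_])
open import Data.List.Membership.Propositional using (_∈_)
open import Data.List.Membership.Propositional.Properties using (∈-map⁻; ∈-map⁺; ∈-++⁻; ∈-++⁺ˡ; ∈-++⁺ʳ; ∈-upTo⁻; ∈-upTo⁺)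
open import Data.List.Membership.Propositional.Properties.WithK using (unique∧set⇒bag)
open import Data.List.Properties using (map-∘; map-++; ++-assoc; ++-identityʳ; length-map; length-upTo; map-applyUpTo; upTo-∷ʳ; map-cong-local; length-++; map-upTo; reverse-map; unfold-reverse; map-id-local)
open import Data.List.Relation.Binary.BagAndSetEquality using (∼bag⇒↭)
open import Data.List.Relation.Binary.Permutation.Propositional as ↭ using (_↭_)
import Data.List.Relation.Binary.Permutation.Propositional.Properties as ↭
open import Data.List.Relation.Unary.All as All using (All)
import Data.List.Relation.Unary.AllPairs as AllPairs
open import Data.List.Relation.Unary.Any using (Any; here; there)
open import Data.List.Relation.Unary.Unique.Propositional using (Unique)
import Data.List.Relation.Unary.Unique.Propositional.Properties as Unique
open import Data.Nat using (ℕ; zero; suc; _+_; _*_; _∸_; _≤_; _<_; z≤n; s≤s; _<ᵇ_; _≡ᵇ_)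
open import Data.Nat.ListAction using (sum)
open import Data.Nat.ListAction.Properties using (sum-++; sum-↭)
open import Data.Nat.Properties
open import Data.Nat.Tactic.RingSolver using (solve-∀)
open import Data.Product using (Σ; _×_; _,_; proj₁; proj₂; ∃-syntax)
open import Data.Sum using (_⊎_; inj₁; inj₂)
open import Function.Base using (_∘_; id; case_of_)
open import Function.Bundles using (mk⇔)
open import Relation.Binary.PropositionalEquality hiding ([_])
open import Relation.Nullary using (yes; no)

private
  variable
    A B : Set
  module ∧ = CommSemigroupProperties (CommutativeMonoid.commutativeSemigroup ∧-commutativeMonoid)
  module + = CommSemigroupProperties +-commutativeSemigroup

∑ : {A : Set} → List A → (A → ℕ) → ℕ
∑ xs g = sum (map g xs)

∑-++ : ∀ (xs ys : List A) g → ∑ (xs ++ ys) g ≡ ∑ xs g + ∑ ys g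
∑-++ xs ys g = trans (cong sum (map-++ g xs ys)) (sum-++ (map g xs) (map g ys))

∑-↭ : ∀ {xs ys : List A} g → xs ↭ ys → ∑ xs g ≡ ∑ ys g
∑-↭ g p = sum-↭ (↭.map⁺ g p)

∑-cong : ∀ (xs : List A) {g h} → (∀ x → x ∈ xs → g x ≡ h x) → ∑ xs g ≡ ∑ xs h
∑-cong []       e = refl
∑-cong (x ∷ xs) e = cong₂ _+_ (e x (here refl)) (∑-cong xs (λ y m → e y (there m)))

∑-ext : ∀ (xs : List A) {g h} → (∀ x → g x ≡ h x) → ∑ xs g ≡ ∑ xs h
∑-ext xs e = ∑-cong xs (λ x _ → e x)

∑-zero : ∀ (xs : List A) {g} → (∀ x → x ∈ xs → g x ≡ 0) → ∑ xs g ≡ 0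
∑-zero []       e = refl
∑-zero (x ∷ xs) e = cong₂ _+_ (e x (here refl)) (∑-zero xs (λ y m → e y (there m)))

∑-one : ∀ (xs : List A) → ∑ xs (λ _ → 1) ≡ length xs
∑-one []       = refl
∑-one (x ∷ xs) = cong suc (∑-one xs)

∑-+ : ∀ (xs : List A) g h → ∑ xs (λ x → g x + h x) ≡ ∑ xs g + ∑ xs h
∑-+ []       g h = refl
∑-+ (x ∷ xs) g h = trans (cong ((g x + h x) +_) (∑-+ xs g h)) (+.interchange (g x) (h x) _ _)

∑-* : ∀ (xs : List A) c g → ∑ xs (λ x → c * g x) ≡ c * ∑ xs g
∑-* []       c g = sym (*-zeroʳ c)
∑-* (x ∷ xs) c g = trans (cong (c * g x +_) (∑-* xs c g)) (sym (*-distribˡ-+ c (g x) (∑ xs g)))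

∑-map : ∀ (h : A → B) xs g → ∑ (map h xs) g ≡ ∑ xs (λ x → g (h x))
∑-map h xs g = cong sum (sym (map-∘ xs))

∑-concatMap : ∀ (h : A → List B) xs g → ∑ (concatMap h xs) g ≡ ∑ xs (λ x → ∑ (h x) g)
∑-concatMap h []       g = refl
∑-concatMap h (x ∷ xs) g = trans (∑-++ (h x) (concatMap h xs) g) (cong (∑ (h x) g +_) (∑-concatMap h xs g))

∑-comm : ∀ (xs : List A) (ys : List B) (g : A → B → ℕ) →
  ∑ xs (λ x → ∑ ys (g x)) ≡ ∑ ys (λ y → ∑ xs (λ x → g x y))
∑-comm []       ys g = sym (∑-zero ys (λ _ _ → refl))
∑-comm (x ∷ xs) ys g = trans (cong (∑ ys (g x) +_) (∑-comm xs ys g))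
  (sym (∑-+ ys (g x) (λ y → ∑ xs (λ x′ → g x′ y))))

allᵇ-cong : ∀ (xs : List A) {p q} → (∀ x → x ∈ xs → p x ≡ q x) → allᵇ p xs ≡ allᵇ q xs
allᵇ-cong []       e = refl
allᵇ-cong (x ∷ xs) e = cong₂ _∧_ (e x (here refl)) (allᵇ-cong xs (λ y m → e y (there m)))

allᵇ-ext : ∀ (xs : List A) {p q} → (∀ x → p x ≡ q x) → allᵇ p xs ≡ allᵇ q xs
allᵇ-ext xs e = allᵇ-cong xs (λ x _ → e x)

allᵇ-↭ : ∀ {xs ys : List A} p → xs ↭ ys → allᵇ p xs ≡ allᵇ p ys
allᵇ-↭ p ↭.refl          = refl
allᵇ-↭ p (↭.prep x q)    = cong (p x ∧_) (allᵇ-↭ p q)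
allᵇ-↭ p (↭.swap x y q)  = trans (∧.x∙yz≈y∙xz (p x) (p y) _) (cong (λ b → p y ∧ (p x ∧ b)) (allᵇ-↭ p q))
allᵇ-↭ p (↭.trans q r)   = trans (allᵇ-↭ p q) (allᵇ-↭ p r)

allᵇ-map : ∀ (h : A → B) xs p → allᵇ p (map h xs) ≡ allᵇ (λ x → p (h x)) xs
allᵇ-map h []       p = refl
allᵇ-map h (x ∷ xs) p = cong (p (h x) ∧_) (allᵇ-map h xs p)

allᵇ-∧ : ∀ (xs : List A) p q → allᵇ (λ x → p x ∧ q x) xs ≡ allᵇ p xs ∧ allᵇ q xs
allᵇ-∧ []       p q = refl
allᵇ-∧ (x ∷ xs) p q = trans (cong ((p x ∧ q x) ∧_) (allᵇ-∧ xs p q)) (∧.interchange (p x) (q x) _ _)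

allᵇ-true : ∀ (xs : List A) → allᵇ (λ _ → true) xs ≡ true
allᵇ-true []       = refl
allᵇ-true (x ∷ xs) = allᵇ-true xs

allᵇ-comm : ∀ (xs : List A) (ys : List B) (P : A → B → Bool) →
  allᵇ (λ x → allᵇ (P x) ys) xs ≡ allᵇ (λ y → allᵇ (λ x → P x y) xs) ys
allᵇ-comm []       ys P = sym (allᵇ-true ys)
allᵇ-comm (x ∷ xs) ys P = trans (cong (allᵇ (P x) ys ∧_) (allᵇ-comm xs ys P))
  (sym (allᵇ-∧ ys (P x) (λ y → allᵇ (λ x′ → P x′ y) xs)))

allᵇ-elim : ∀ {xs : List A} {x} p → allᵇ p xs ≡ true → x ∈ xs → p x ≡ true
allᵇ-elim {xs = y ∷ ys} p e m with p y in py
allᵇ-elim {xs = y ∷ ys} p e (here refl) | true = py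
allᵇ-elim {xs = y ∷ ys} p e (there m)   | true = allᵇ-elim p e m

allᵇ-intro : ∀ (xs : List A) p → (∀ x → x ∈ xs → p x ≡ true) → allᵇ p xs ≡ true
allᵇ-intro []       p e = refl
allᵇ-intro (x ∷ xs) p e rewrite e x (here refl) = allᵇ-intro xs p (λ y m → e y (there m))

allᵇ-false : ∀ (xs : List A) {x} p → x ∈ xs → p x ≡ false → allᵇ p xs ≡ false
allᵇ-false (y ∷ ys) p (here refl) e rewrite e = refl
allᵇ-false (y ∷ ys) p (there m) e with p y
... | true  = allᵇ-false ys p m e
... | false = refl

≡ᵇ-refl : ∀ n → (n ≡ᵇ n) ≡ true
≡ᵇ-refl zero    = refl
≡ᵇ-refl (suc n) = ≡ᵇ-refl n

≡ᵇ-true⁻ : ∀ m n → (m ≡ᵇ n) ≡ true → m ≡ n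
≡ᵇ-true⁻ zero    zero    e = refl
≡ᵇ-true⁻ (suc m) (suc n) e = cong suc (≡ᵇ-true⁻ m n e)

≡ᵇ-false : ∀ m n → m ≢ n → (m ≡ᵇ n) ≡ false
≡ᵇ-false zero    zero    m≢n = ⊥-elim (m≢n refl)
≡ᵇ-false zero    (suc n) m≢n = refl
≡ᵇ-false (suc m) zero    m≢n = refl
≡ᵇ-false (suc m) (suc n) m≢n = ≡ᵇ-false m n (m≢n ∘ cong suc)

≡ᵇ-sym : ∀ m n → (m ≡ᵇ n) ≡ (n ≡ᵇ m)
≡ᵇ-sym zero    zero    = refl
≡ᵇ-sym zero    (suc n) = refl
≡ᵇ-sym (suc m) zero    = refl
≡ᵇ-sym (suc m) (suc n) = ≡ᵇ-sym m n

<ᵇ-true : ∀ m n → m < n → (m <ᵇ n) ≡ true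
<ᵇ-true zero    (suc n) _         = refl
<ᵇ-true (suc m) (suc n) (s≤s m<n) = <ᵇ-true m n m<n

<ᵇ-false : ∀ m n → n ≤ m → (m <ᵇ n) ≡ false
<ᵇ-false m       zero    _         = refl
<ᵇ-false (suc m) (suc n) (s≤s n≤m) = <ᵇ-false m n n≤m

<ᵇ-true⁻ : ∀ m n → (m <ᵇ n) ≡ true → m < n
<ᵇ-true⁻ zero    (suc n) e = s≤s z≤n
<ᵇ-true⁻ (suc m) (suc n) e = s≤s (<ᵇ-true⁻ m n e)

<ᵇ-false⁻ : ∀ m n → (m <ᵇ n) ≡ false → n ≤ m
<ᵇ-false⁻ m       zero    e = z≤n
<ᵇ-false⁻ (suc m) (suc n) e = s≤s (<ᵇ-false⁻ m n e)

<ᵇ-irrefl : ∀ n → (n <ᵇ n) ≡ false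
<ᵇ-irrefl n = <ᵇ-false n n ≤-refl

≡ᵇ-via-<ᵇ : ∀ m n → (m ≡ᵇ n) ≡ not (m <ᵇ n) ∧ not (n <ᵇ m)
≡ᵇ-via-<ᵇ zero    zero    = refl
≡ᵇ-via-<ᵇ zero    (suc n) = refl
≡ᵇ-via-<ᵇ (suc m) zero    = refl
≡ᵇ-via-<ᵇ (suc m) (suc n) = ≡ᵇ-via-<ᵇ m n

Bool-ext : ∀ {b c : Bool} → (b ≡ true → c ≡ true) → (c ≡ true → b ≡ true) → b ≡ c
Bool-ext {true}  {true}  f g = refl
Bool-ext {true}  {false} f g = sym (f refl)
Bool-ext {false} {true}  f g = g refl
Bool-ext {false} {false} f g = refl

∨-true⁻ : ∀ a b → not a ∨ b ≡ true → a ≡ true → b ≡ true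
∨-true⁻ true b e refl = e

𝟙 : Bool → ℕ
𝟙 b = if b then 1 else 0

values : ℕ → List ℕ
values N = range 1 (suc N)

values-∷ʳ : ∀ N → values (suc N) ≡ values N ++ [ suc N ]
values-∷ʳ N = trans (cong (map (1 +_)) (sym (upTo-∷ʳ N))) (map-++ (1 +_) (upTo N) [ N ])

values-∷ : ∀ N → values (suc N) ≡ 1 ∷ map suc (values N)
values-∷ N = cong (λ vs → 1 ∷ map suc vs) (sym (map-upTo suc N))

∈-values⁻ : ∀ N {v} → v ∈ values N → 1 ≤ v × v ≤ N
∈-values⁻ (suc N) m rewrite values-∷ N with m
... | here refl = s≤s z≤n , s≤s z≤n
... | there m′ with ∈-map⁻ suc m′
...   | u , mu , refl = s≤s z≤n , s≤s (proj₂ (∈-values⁻ N mu))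

∈-values⁺ : ∀ N {v} → 1 ≤ v → v ≤ N → v ∈ values N
∈-values⁺ (suc N) {suc zero}    _ _         rewrite values-∷ N = here refl
∈-values⁺ (suc N) {suc (suc v)} _ (s≤s v≤N) rewrite values-∷ N =
  there (∈-map⁺ suc (∈-values⁺ N (s≤s z≤n) v≤N))

length-values : ∀ N → length (values N) ≡ N
length-values N = trans (length-map (1 +_) (upTo N)) (length-upTo N)

∑-values-∷ʳ : ∀ M g → ∑ (values (suc M)) g ≡ ∑ (values M) g + (g (suc M) + 0)
∑-values-∷ʳ M g = trans (cong (λ vs → ∑ vs g) (values-∷ʳ M)) (∑-++ (values M) [ suc M ] g)

count-values-≤ : ∀ M v → v ≤ M → ∑ (values M) (λ k → 𝟙 (k <ᵇ suc v)) ≡ v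
count-values-≤ zero .zero z≤n = refl
count-values-≤ (suc M) v v≤1+M with m≤n⇒m<n∨m≡n v≤1+M
... | inj₁ (s≤s v≤M) = begin
  ∑ (values (suc M)) (λ k → 𝟙 (k <ᵇ suc v)) ≡⟨ ∑-values-∷ʳ M _ ⟩
  ∑ (values M) (λ k → 𝟙 (k <ᵇ suc v)) + (𝟙 (suc M <ᵇ suc v) + 0)
    ≡⟨ cong₂ (λ s b → s + (𝟙 b + 0)) (count-values-≤ M v v≤M) (<ᵇ-false (suc M) (suc v) (s≤s v≤M)) ⟩
  v + 0 ≡⟨ +-identityʳ v ⟩
  v ∎
  where open ≡-Reasoning
... | inj₂ refl = begin
  ∑ (values (suc M)) (λ k → 𝟙 (k <ᵇ suc (suc M))) ≡⟨ ∑-values-∷ʳ M _ ⟩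
  ∑ (values M) (λ k → 𝟙 (k <ᵇ suc (suc M))) + (𝟙 (suc M <ᵇ suc (suc M)) + 0)
    ≡⟨ cong₂ (λ s b → s + (𝟙 b + 0)) (∑-cong (values M) all-below) (<ᵇ-true (suc M) (suc (suc M)) ≤-refl) ⟩
  ∑ (values M) (λ _ → 1) + 1 ≡⟨ cong (_+ 1) (trans (∑-one (values M)) (length-values M)) ⟩
  M + 1 ≡⟨ +-comm M 1 ⟩
  suc M ∎
  where
  open ≡-Reasoning
  all-below : ∀ k → k ∈ values M → 𝟙 (k <ᵇ suc (suc M)) ≡ 1
  all-below k mk = cong 𝟙 (<ᵇ-true k (suc (suc M)) (s≤s (m≤n⇒m≤1+n (proj₂ (∈-values⁻ M mk)))))

count-values-> : ∀ M v → v ≤ M → ∑ (values M) (λ k → 𝟙 (v <ᵇ k)) ≡ M ∸ v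
count-values-> zero .zero z≤n = refl
count-values-> (suc M) v v≤1+M with m≤n⇒m<n∨m≡n v≤1+M
... | inj₁ (s≤s v≤M) = begin
  ∑ (values (suc M)) (λ k → 𝟙 (v <ᵇ k)) ≡⟨ ∑-values-∷ʳ M _ ⟩
  ∑ (values M) (λ k → 𝟙 (v <ᵇ k)) + (𝟙 (v <ᵇ suc M) + 0)
    ≡⟨ cong₂ (λ s b → s + (𝟙 b + 0)) (count-values-> M v v≤M) (<ᵇ-true v (suc M) (s≤s v≤M)) ⟩
  M ∸ v + 1 ≡⟨ +-comm (M ∸ v) 1 ⟩
  suc (M ∸ v) ≡⟨ +-∸-assoc 1 v≤M ⟨
  suc M ∸ v ∎
  where open ≡-Reasoning
... | inj₂ refl = begin
  ∑ (values (suc M)) (λ k → 𝟙 (suc M <ᵇ k)) ≡⟨ ∑-values-∷ʳ M _ ⟩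
  ∑ (values M) (λ k → 𝟙 (suc M <ᵇ k)) + (𝟙 (suc M <ᵇ suc M) + 0)
    ≡⟨ cong₂ (λ s b → s + (𝟙 b + 0)) (∑-zero (values M) none-above) (<ᵇ-irrefl (suc M)) ⟩
  0 ≡⟨ n∸n≡0 M ⟨
  M ∸ M ∎
  where
  open ≡-Reasoning
  none-above : ∀ k → k ∈ values M → 𝟙 (suc M <ᵇ k) ≡ 0
  none-above k mk = cong 𝟙 (<ᵇ-false (suc M) k (m≤n⇒m≤1+n (proj₂ (∈-values⁻ M mk))))

values-complement : ∀ N → map (suc N ∸_) (values N) ≡ reverse (values N)
values-complement zero    = refl
values-complement (suc N) = begin
  map (2+N ∸_) (values (suc N))                 ≡⟨ cong (map (2+N ∸_)) (values-∷ʳ N) ⟩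
  map (2+N ∸_) (values N ++ [ suc N ])          ≡⟨ map-++ (2+N ∸_) (values N) [ suc N ] ⟩
  map (2+N ∸_) (values N) ++ [ 2+N ∸ suc N ]    ≡⟨ cong₂ (λ vs v → vs ++ [ v ]) shift (m+n∸n≡m 1 (suc N)) ⟩
  map suc (map (suc N ∸_) (values N)) ++ [ 1 ]  ≡⟨ cong (λ vs → map suc vs ++ [ 1 ]) (values-complement N) ⟩
  map suc (reverse (values N)) ++ [ 1 ]         ≡⟨ cong (_++ [ 1 ]) (reverse-map suc (values N)) ⟩
  reverse (map suc (values N)) ++ [ 1 ]         ≡⟨ unfold-reverse 1 (map suc (values N)) ⟨
  reverse (1 ∷ map suc (values N))              ≡⟨ cong reverse (values-∷ N) ⟨
  reverse (values (suc N))                      ∎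
  where
  open ≡-Reasoning
  2+N = suc (suc N)
  shift : map (2+N ∸_) (values N) ≡ map suc (map (suc N ∸_) (values N))
  shift = trans (map-cong-local (All.tabulate (λ mv → +-∸-assoc 1 (m≤n⇒m≤1+n (proj₂ (∈-values⁻ N mv))))))
                (map-∘ (values N))

values-complement-↭ : ∀ N → map (suc N ∸_) (values N) ↭ values N
values-complement-↭ N = subst (_↭ values N) (sym (values-complement N)) (↭.↭-reverse (values N))

skip : ℕ → ℕ → ℕ
skip k v = if v <ᵇ k then v else suc v

values-split : ∀ N k → 1 ≤ k → k ≤ suc N → values (suc N) ↭ k ∷ map (skip k) (values N)
values-split zero    (suc zero)    _   _           = ↭.refl
values-split zero    (suc (suc k)) _   (s≤s ())
values-split (suc N) k         1≤k k≤2+N with m≤n⇒m<n∨m≡n k≤2+N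
... | inj₁ (s≤s k≤1+N) = begin
  values (suc (suc N))                           ≡⟨ values-∷ʳ (suc N) ⟩
  values (suc N) ++ [ 2+N ]                      ↭⟨ ↭.++⁺ʳ [ 2+N ] (values-split N k 1≤k k≤1+N) ⟩
  k ∷ map (skip k) (values N) ++ [ 2+N ]         ≡⟨ cong (λ b → k ∷ map (skip k) (values N) ++ [ if b then suc N else 2+N ])
                                                         (<ᵇ-false (suc N) k k≤1+N) ⟨
  k ∷ map (skip k) (values N) ++ [ skip k (suc N) ] ≡⟨ cong (k ∷_) (map-++ (skip k) (values N) [ suc N ]) ⟨
  k ∷ map (skip k) (values N ++ [ suc N ])       ≡⟨ cong (λ vs → k ∷ map (skip k) vs) (values-∷ʳ N) ⟨
  k ∷ map (skip k) (values (suc N))              ∎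
  where
  open ↭.PermutationReasoning
  2+N = suc (suc N)
... | inj₂ refl = begin
  values (suc (suc N))                           ≡⟨ values-∷ʳ (suc N) ⟩
  values (suc N) ++ [ 2+N ]                      ↭⟨ ↭.∷↭∷ʳ 2+N (values (suc N)) ⟨
  2+N ∷ values (suc N)                           ≡⟨ cong (2+N ∷_) (map-id-local (All.tabulate below)) ⟨
  2+N ∷ map (skip 2+N) (values (suc N))          ∎
  where
  open ↭.PermutationReasoning
  2+N = suc (suc N)
  below : ∀ {v} → v ∈ values (suc N) → skip 2+N v ≡ v
  below {v} mv = cong (λ b → if b then v else suc v) (<ᵇ-true v 2+N (s≤s (proj₂ (∈-values⁻ (suc N) mv))))

skip-≢ : ∀ k v → (skip k v ≡ᵇ k) ≡ false
skip-≢ k v with v <ᵇ k in e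
... | true  = ≡ᵇ-false v k (λ v≡k → <-irrefl v≡k (<ᵇ-true⁻ v k e))
... | false = ≡ᵇ-false (suc v) k (λ 1+v≡k → <-irrefl (sym 1+v≡k) (s≤s (<ᵇ-false⁻ v k e)))

skip-<ᵇ : ∀ k v j → (skip k v <ᵇ skip k j) ≡ (v <ᵇ j)
skip-<ᵇ k v j with v <ᵇ k in e₁ | j <ᵇ k in e₂
... | true  | true  = refl
... | false | false = refl
... | true  | false = trans (<ᵇ-true v (suc j) (m≤n⇒m≤1+n v<j)) (sym (<ᵇ-true v j v<j))
  where v<j = <-≤-trans (<ᵇ-true⁻ v k e₁) (<ᵇ-false⁻ j k e₂)
... | false | true  = trans (<ᵇ-false (suc v) j (m≤n⇒m≤1+n j≤v)) (sym (<ᵇ-false v j j≤v))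
  where j≤v = <⇒≤ (<-≤-trans (<ᵇ-true⁻ j k e₂) (<ᵇ-false⁻ v k e₁))

skip-≡ᵇ : ∀ k v j → (skip k v ≡ᵇ skip k j) ≡ (v ≡ᵇ j)
skip-≡ᵇ k v j rewrite ≡ᵇ-via-<ᵇ (skip k v) (skip k j) | skip-<ᵇ k v j | skip-<ᵇ k j v = sym (≡ᵇ-via-<ᵇ v j)

<ᵇ-skip : ∀ k v → (k <ᵇ skip k v) ≡ (k <ᵇ suc v)
<ᵇ-skip k v with v <ᵇ k in e
... | true  = trans (<ᵇ-false k v (<⇒≤ v<k)) (sym (<ᵇ-false k (suc v) v<k))
  where v<k = <ᵇ-true⁻ v k e
... | false = refl

skip-<ᵇ-self : ∀ k v → (skip k v <ᵇ k) ≡ (v <ᵇ k)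
skip-<ᵇ-self k v with v <ᵇ k in e
... | true  = e
... | false = <ᵇ-false (suc v) k (m≤n⇒m≤1+n (<ᵇ-false⁻ v k e))

∑-allFillings-∷ : ∀ c cs N (g : Filling → ℕ) →
  ∑ (allFillings (c ∷ cs) N) g ≡ ∑ (values N) (λ v → ∑ (allFillings cs N) (λ T → g ((c , v) ∷ T)))
∑-allFillings-∷ c cs N g = trans (∑-concatMap (λ v → map ((c , v) ∷_) (allFillings cs N)) (values N) g)
  (∑-ext (values N) (λ v → ∑-map ((c , v) ∷_) (allFillings cs N) g))

PermutationInvariant : (Filling → ℕ) → Set
PermutationInvariant g = ∀ {T T′} → T ↭ T′ → g T ≡ g T′

∑-allFillings-↭ : ∀ N {cs cs′} → cs ↭ cs′ → (g : Filling → ℕ) → PermutationInvariant g →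
  ∑ (allFillings cs N) g ≡ ∑ (allFillings cs′ N) g
∑-allFillings-↭ N ↭.refl g g↭ = refl
∑-allFillings-↭ N (↭.prep {xs} {ys} x p) g g↭ = begin
  ∑ (allFillings (x ∷ xs) N) g ≡⟨ ∑-allFillings-∷ x xs N g ⟩
  ∑ (values N) (λ v → ∑ (allFillings xs N) (λ T → g ((x , v) ∷ T)))
    ≡⟨ ∑-ext (values N) (λ v → ∑-allFillings-↭ N p _ (g↭ ∘ ↭.prep _)) ⟩
  ∑ (values N) (λ v → ∑ (allFillings ys N) (λ T → g ((x , v) ∷ T))) ≡⟨ ∑-allFillings-∷ x ys N g ⟨
  ∑ (allFillings (x ∷ ys) N) g ∎
  where open ≡-Reasoning
∑-allFillings-↭ N (↭.swap {xs} {ys} x y p) g g↭ = begin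
  ∑ (allFillings (x ∷ y ∷ xs) N) g
    ≡⟨ trans (∑-allFillings-∷ x (y ∷ xs) N g) (∑-ext (values N) (λ v → ∑-allFillings-∷ y xs N _)) ⟩
  ∑ (values N) (λ v → ∑ (values N) (λ u → ∑ (allFillings xs N) (λ T → g ((x , v) ∷ (y , u) ∷ T))))
    ≡⟨ ∑-comm (values N) (values N) _ ⟩
  ∑ (values N) (λ u → ∑ (values N) (λ v → ∑ (allFillings xs N) (λ T → g ((x , v) ∷ (y , u) ∷ T))))
    ≡⟨ ∑-ext (values N) (λ u → ∑-ext (values N) (λ v → ∑-allFillings-↭ N p _ (g↭ ∘ ↭.prep _ ∘ ↭.prep _))) ⟩
  ∑ (values N) (λ u → ∑ (values N) (λ v → ∑ (allFillings ys N) (λ T → g ((x , v) ∷ (y , u) ∷ T))))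
    ≡⟨ ∑-ext (values N) (λ u → ∑-ext (values N) (λ v → ∑-ext (allFillings ys N) (λ T → g↭ (↭.swap _ _ ↭.refl)))) ⟩
  ∑ (values N) (λ u → ∑ (values N) (λ v → ∑ (allFillings ys N) (λ T → g ((y , u) ∷ (x , v) ∷ T))))
    ≡⟨ trans (∑-allFillings-∷ y (x ∷ ys) N g) (∑-ext (values N) (λ u → ∑-allFillings-∷ x ys N _)) ⟨
  ∑ (allFillings (y ∷ x ∷ ys) N) g ∎
  where open ≡-Reasoning
∑-allFillings-↭ N (↭.trans p q) g g↭ = trans (∑-allFillings-↭ N p g g↭) (∑-allFillings-↭ N q g g↭)

relabel : (Cell → Cell) → Filling → Filling
relabel φ = map (λ p → (φ (proj₁ p) , proj₂ p))

∑-allFillings-map : ∀ (φ : Cell → Cell) cs N (g : Filling → ℕ) →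
  ∑ (allFillings (map φ cs) N) g ≡ ∑ (allFillings cs N) (g ∘ relabel φ)
∑-allFillings-map φ []       N g = refl
∑-allFillings-map φ (c ∷ cs) N g = begin
  ∑ (allFillings (φ c ∷ map φ cs) N) g ≡⟨ ∑-allFillings-∷ (φ c) (map φ cs) N g ⟩
  ∑ (values N) (λ v → ∑ (allFillings (map φ cs) N) (λ T → g ((φ c , v) ∷ T)))
    ≡⟨ ∑-ext (values N) (λ v → ∑-allFillings-map φ cs N _) ⟩
  ∑ (values N) (λ v → ∑ (allFillings cs N) (λ T → g ((φ c , v) ∷ relabel φ T)))
    ≡⟨ ∑-allFillings-∷ c cs N (g ∘ relabel φ) ⟨
  ∑ (allFillings (c ∷ cs) N) (g ∘ relabel φ) ∎
  where open ≡-Reasoning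

complement : ℕ → Filling → Filling
complement N = map (λ p → (proj₁ p , suc N ∸ proj₂ p))

∑-allFillings-complement : ∀ cs N (g : Filling → ℕ) →
  ∑ (allFillings cs N) g ≡ ∑ (allFillings cs N) (g ∘ complement N)
∑-allFillings-complement []       N g = refl
∑-allFillings-complement (c ∷ cs) N g = begin
  ∑ (allFillings (c ∷ cs) N) g ≡⟨ ∑-allFillings-∷ c cs N g ⟩
  ∑ (values N) (λ v → ∑ (allFillings cs N) (λ T → g ((c , v) ∷ T)))
    ≡⟨ ∑-ext (values N) (λ v → ∑-allFillings-complement cs N _) ⟩
  ∑ (values N) h                           ≡⟨ ∑-↭ h (values-complement-↭ N) ⟨
  ∑ (map (suc N ∸_) (values N)) h          ≡⟨ ∑-map (suc N ∸_) (values N) h ⟩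
  ∑ (values N) (λ v → h (suc N ∸ v))       ≡⟨ ∑-allFillings-∷ c cs N (g ∘ complement N) ⟨
  ∑ (allFillings (c ∷ cs) N) (g ∘ complement N) ∎
  where
  open ≡-Reasoning
  h : ℕ → ℕ
  h v = ∑ (allFillings cs N) (λ T → g ((c , v) ∷ complement N T))

data FillingOf (N : ℕ) : List Cell → Filling → Set where
  []   : FillingOf N [] []
  fill : ∀ {c cs v T} → 1 ≤ v → v ≤ N → FillingOf N cs T → FillingOf N (c ∷ cs) ((c , v) ∷ T)

∑-allFillings-cong : ∀ cs N {g h : Filling → ℕ} → (∀ T → FillingOf N cs T → g T ≡ h T) →
  ∑ (allFillings cs N) g ≡ ∑ (allFillings cs N) h
∑-allFillings-cong []       N e = cong (_+ 0) (e [] [])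
∑-allFillings-cong (c ∷ cs) N {g} {h} e = begin
  ∑ (allFillings (c ∷ cs) N) g ≡⟨ ∑-allFillings-∷ c cs N g ⟩
  ∑ (values N) (λ v → ∑ (allFillings cs N) (λ T → g ((c , v) ∷ T)))
    ≡⟨ ∑-cong (values N) (λ v mv → let (1≤v , v≤N) = ∈-values⁻ N mv in
                            ∑-allFillings-cong cs N (λ T T∈ → e _ (fill 1≤v v≤N T∈))) ⟩
  ∑ (values N) (λ v → ∑ (allFillings cs N) (λ T → h ((c , v) ∷ T))) ≡⟨ ∑-allFillings-∷ c cs N h ⟨
  ∑ (allFillings (c ∷ cs) N) h ∎
  where open ≡-Reasoning

FillingOf-entry : ∀ {N cs T p} → FillingOf N cs T → p ∈ T → 1 ≤ proj₂ p × proj₂ p ≤ N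
FillingOf-entry (fill 1≤v v≤N _) (here refl) = 1≤v , v≤N
FillingOf-entry (fill _ _ T∈)    (there m)   = FillingOf-entry T∈ m

FillingOf-cell : ∀ {N cs T p} → FillingOf N cs T → p ∈ T → proj₁ p ∈ cs
FillingOf-cell (fill _ _ _)  (here refl) = here refl
FillingOf-cell (fill _ _ T∈) (there m)   = there (FillingOf-cell T∈ m)

_≺_ : Cell → Cell → Bool
(i , j) ≺ (i′ , j′) = ((i ≡ᵇ i′) ∧ (j <ᵇ j′)) ∨ ((j ≡ᵇ j′) ∧ (i <ᵇ i′))

pairOK-≺ : ∀ a b v v′ → pairOK (a , v) (b , v′) ≡ not (a ≺ b) ∨ (v <ᵇ v′)
pairOK-≺ (i , j) (i′ , j′) v v′ = de-morgan ((i ≡ᵇ i′) ∧ (j <ᵇ j′)) ((j ≡ᵇ j′) ∧ (i <ᵇ i′)) (v <ᵇ v′)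
  where
  de-morgan : ∀ p r q → (not p ∨ q) ∧ (not r ∨ q) ≡ not (p ∨ r) ∨ q
  de-morgan p     r     true  = trans (cong₂ _∧_ (∨-zeroʳ (not p)) (∨-zeroʳ (not r))) (sym (∨-zeroʳ _))
  de-morgan true  r     false = refl
  de-morgan false true  false = refl
  de-morgan false false false = refl

pairOK-refl : ∀ c k → pairOK (c , k) (c , k) ≡ true
pairOK-refl (i , j) k rewrite ≡ᵇ-refl i | ≡ᵇ-refl j | <ᵇ-irrefl i | <ᵇ-irrefl j = refl

increasing-∈ : ∀ {T p q} → increasing T ≡ true → p ∈ T → q ∈ T → pairOK p q ≡ true
increasing-∈ {T} {p} e p∈ q∈ = allᵇ-elim (pairOK p) (allᵇ-elim (λ p → allᵇ (pairOK p) T) e p∈) q∈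

isSYT-↭ : ∀ N {T T′ : Filling} → T ↭ T′ → isSYT N T ≡ isSYT N T′
isSYT-↭ N {T} {T′} p = cong₂ _∧_
  (allᵇ-ext (values N) (λ k → cong (_≡ᵇ 1) (∑-↭ (λ q → 𝟙 (proj₂ q ≡ᵇ k)) p)))
  (trans (allᵇ-ext T (λ q → allᵇ-↭ (pairOK q) p)) (allᵇ-↭ (λ q → allᵇ (pairOK q) T′) p))

isSYT-relabel : ∀ (φ : Cell → Cell) → (∀ a b → φ a ≺ φ b ≡ a ≺ b) →
  ∀ N T → isSYT N (relabel φ T) ≡ isSYT N T
isSYT-relabel φ φ-≺ N T = cong₂ _∧_
  (allᵇ-ext (values N) (λ k → cong (_≡ᵇ 1) (∑-map Φ T (λ q → 𝟙 (proj₂ q ≡ᵇ k)))))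
  (trans (allᵇ-map Φ T (λ p → allᵇ (pairOK p) (relabel φ T)))
    (allᵇ-ext T (λ p → trans (allᵇ-map Φ T (pairOK (Φ p))) (allᵇ-ext T (λ q → pairOK-relabel p q)))))
  where
  Φ : Cell × ℕ → Cell × ℕ
  Φ (c , v) = (φ c , v)
  pairOK-relabel : ∀ p q → pairOK (Φ p) (Φ q) ≡ pairOK p q
  pairOK-relabel (a , v) (b , v′) = begin
    pairOK (φ a , v) (φ b , v′) ≡⟨ pairOK-≺ (φ a) (φ b) v v′ ⟩
    not (φ a ≺ φ b) ∨ (v <ᵇ v′) ≡⟨ cong (λ x → not x ∨ (v <ᵇ v′)) (φ-≺ a b) ⟩
    not (a ≺ b) ∨ (v <ᵇ v′)     ≡⟨ pairOK-≺ a b v v′ ⟨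
    pairOK (a , v) (b , v′)     ∎
    where open ≡-Reasoning

_≡ᶜ_ : Cell → Cell → Bool
(a , b) ≡ᶜ (c , d) = (a ≡ᵇ c) ∧ (b ≡ᵇ d)

≡ᶜ-refl : ∀ c → (c ≡ᶜ c) ≡ true
≡ᶜ-refl (a , b) rewrite ≡ᵇ-refl a | ≡ᵇ-refl b = refl

≡ᶜ-true⁻ : ∀ c d → (c ≡ᶜ d) ≡ true → c ≡ d
≡ᶜ-true⁻ (a , b) (c , d) e with a ≡ᵇ c in e₁ | b ≡ᵇ d in e₂
... | true | true = cong₂ _,_ (≡ᵇ-true⁻ a c e₁) (≡ᵇ-true⁻ b d e₂)

multiplicity : Cell → List Cell → ℕ
multiplicity y cs = ∑ cs (λ c → 𝟙 (c ≡ᶜ y))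

entry : Cell → Filling → ℕ
entry y T = ∑ T (λ p → if proj₁ p ≡ᶜ y then proj₂ p else 0)

entry-↭ : ∀ y → PermutationInvariant (entry y)
entry-↭ y = ∑-↭ (λ p → if proj₁ p ≡ᶜ y then proj₂ p else 0)

∑-at-absent : ∀ {N cs T} y (h : ℕ → ℕ) → FillingOf N cs T → multiplicity y cs ≡ 0 →
  ∑ T (λ p → if proj₁ p ≡ᶜ y then h (proj₂ p) else 0) ≡ 0
∑-at-absent y h []                 e = refl
∑-at-absent y h (fill {c} _ _ T∈) e with c ≡ᶜ y
... | false = ∑-at-absent y h T∈ e

∑-at-simple : ∀ {N cs T} y (h : ℕ → ℕ) → FillingOf N cs T → multiplicity y cs ≡ 1 →
  ∑ T (λ p → if proj₁ p ≡ᶜ y then h (proj₂ p) else 0) ≡ h (entry y T)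
∑-at-simple y h (fill {c} {v = v} {T} _ _ T∈) e with c ≡ᶜ y
... | false = ∑-at-simple y h T∈ e
... | true  = begin
  h v + ∑ T (λ p → if proj₁ p ≡ᶜ y then h (proj₂ p) else 0) ≡⟨ cong (h v +_) (∑-at-absent y h T∈ (suc-injective e)) ⟩
  h v + 0                                                    ≡⟨ +-identityʳ (h v) ⟩
  h v                                                        ≡⟨ cong h (+-identityʳ v) ⟨
  h (v + 0)                                                  ≡⟨ cong (λ s → h (v + s)) (∑-at-absent y id T∈ (suc-injective e)) ⟨
  h (v + ∑ T (λ p → if proj₁ p ≡ᶜ y then proj₂ p else 0))    ∎
  where open ≡-Reasoning

entry-∈ : ∀ {N cs T} y → FillingOf N cs T → multiplicity y cs ≡ 1 → (y , entry y T) ∈ T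
entry-∈ y (fill {c} {v = v} _ _ T∈) e with c ≡ᶜ y in c≡y
... | false = there (entry-∈ y T∈ e)
... | true rewrite ≡ᶜ-true⁻ c y c≡y | ∑-at-absent y id T∈ (suc-injective e) | +-identityʳ v = here refl

∉-absent : ∀ {N cs T} y {v} → FillingOf N cs T → multiplicity y cs ≡ 0 → (y , v) ∈ T → ⊥
∉-absent y (fill {c} _ _ T∈) e m with c ≡ᶜ y in c≡y | m
... | false | here refl = case trans (sym c≡y) (≡ᶜ-refl y) of λ ()
... | false | there m′  = ∉-absent y T∈ e m′

entry-unique : ∀ {N cs T} y {v} → FillingOf N cs T → multiplicity y cs ≡ 1 → (y , v) ∈ T → v ≡ entry y T
entry-unique y (fill {c} {v = v} _ _ T∈) e (here refl) rewrite ≡ᶜ-refl y | ∑-at-absent y id T∈ (suc-injective e) =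
  sym (+-identityʳ v)
entry-unique y (fill {c} _ _ T∈) e (there m) with c ≡ᶜ y
... | true  = ⊥-elim (∉-absent y T∈ (suc-injective e) m)
... | false = entry-unique y T∈ e m

-- Sums of an entry over all standard tableaux

#SYT : List Cell → ℕ → ℕ
#SYT cs N = ∑ (allFillings cs N) (𝟙 ∘ isSYT N)

onSYT : ℕ → (Filling → ℕ) → Filling → ℕ
onSYT N h T = if isSYT N T then h T else 0

#SYT-↭ : ∀ N {cs cs′} → cs ↭ cs′ → #SYT cs N ≡ #SYT cs′ N
#SYT-↭ N p = ∑-allFillings-↭ N p (𝟙 ∘ isSYT N) (cong 𝟙 ∘ isSYT-↭ N)

∑-entry+complement : ∀ cs N y → multiplicity y cs ≡ 1 →
  ∑ (allFillings cs N) (onSYT N (entry y)) + ∑ (allFillings cs N) (onSYT N (λ T → suc N ∸ entry y T))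
    ≡ suc N * #SYT cs N
∑-entry+complement cs N y y-simple = begin
  ∑ (allFillings cs N) (onSYT N (entry y)) + ∑ (allFillings cs N) (onSYT N (λ T → suc N ∸ entry y T))
    ≡⟨ ∑-+ (allFillings cs N) _ _ ⟨
  ∑ (allFillings cs N) (λ T → onSYT N (entry y) T + onSYT N (λ T → suc N ∸ entry y T) T)
    ≡⟨ ∑-allFillings-cong cs N pointwise ⟩
  ∑ (allFillings cs N) (λ T → suc N * 𝟙 (isSYT N T)) ≡⟨ ∑-* (allFillings cs N) (suc N) (𝟙 ∘ isSYT N) ⟩
  suc N * #SYT cs N ∎
  where
  open ≡-Reasoning
  pointwise : ∀ T → FillingOf N cs T →
    onSYT N (entry y) T + onSYT N (λ T → suc N ∸ entry y T) T ≡ suc N * 𝟙 (isSYT N T)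
  pointwise T T∈ with isSYT N T
  ... | true  = trans (m+[n∸m]≡n (m≤n⇒m≤1+n (proj₂ (FillingOf-entry T∈ (entry-∈ y T∈ y-simple)))))
                      (sym (*-identityʳ (suc N)))
  ... | false = sym (*-zeroʳ (suc N))

∸-≡ᵇ : ∀ K a b → a ≤ K → b ≤ K → (K ∸ a ≡ᵇ b) ≡ (a ≡ᵇ K ∸ b)
∸-≡ᵇ K a b a≤K b≤K = Bool-ext
  (λ e → subst (λ x → (a ≡ᵇ x) ≡ true) (trans (sym (m∸[m∸n]≡n a≤K)) (cong (K ∸_) (≡ᵇ-true⁻ (K ∸ a) b e))) (≡ᵇ-refl a))
  (λ e → subst (λ x → (x ≡ᵇ b) ≡ true) (trans (sym (m∸[m∸n]≡n b≤K)) (cong (K ∸_) (sym (≡ᵇ-true⁻ a (K ∸ b) e)))) (≡ᵇ-refl b))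

∸-<ᵇ : ∀ K a b → a ≤ K → (K ∸ a <ᵇ K ∸ b) ≡ (b <ᵇ a)
∸-<ᵇ K a b a≤K = Bool-ext
  (λ e → <ᵇ-true b a (∸-cancelʳ-< (<ᵇ-true⁻ (K ∸ a) (K ∸ b) e)))
  (λ e → <ᵇ-true (K ∸ a) (K ∸ b) (∸-monoʳ-< (<ᵇ-true⁻ b a e) a≤K))

module _ (φ : Cell → Cell) {N cs T} (T∈ : FillingOf N cs T) where

  private
    Φ : Cell × ℕ → Cell × ℕ
    Φ (c , v) = (φ c , suc N ∸ v)

    Φ-≡ : relabel φ (complement N T) ≡ map Φ T
    Φ-≡ = sym (map-∘ T)

    ≤1+N : ∀ {p} → p ∈ T → proj₂ p ≤ suc N
    ≤1+N p∈ = m≤n⇒m≤1+n (proj₂ (FillingOf-entry T∈ p∈))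

  entry-antiautomorphism : ∀ y → (∀ c → c ∈ cs → (φ c ≡ᶜ y) ≡ (c ≡ᶜ y)) → multiplicity y cs ≡ 1 →
    entry y (relabel φ (complement N T)) ≡ suc N ∸ entry y T
  entry-antiautomorphism y φ-y y-simple rewrite Φ-≡ =
    trans (∑-map Φ T (λ p → if proj₁ p ≡ᶜ y then proj₂ p else 0))
      (trans (∑-cong T (λ p p∈ → cong (λ b → if b then suc N ∸ proj₂ p else 0) (φ-y _ (FillingOf-cell T∈ p∈))))
        (∑-at-simple y (suc N ∸_) T∈ y-simple))

  usesEachOnce-antiautomorphism : usesEachOnce N (relabel φ (complement N T)) ≡ usesEachOnce N T
  usesEachOnce-antiautomorphism rewrite Φ-≡ = begin
    allᵇ (λ k → countVal k (map Φ T) ≡ᵇ 1) (values N)          ≡⟨ allᵇ-cong (values N) (λ k k∈ → cong (_≡ᵇ 1) (countVal-Φ k k∈)) ⟩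
    allᵇ (λ k → countVal (suc N ∸ k) T ≡ᵇ 1) (values N)        ≡⟨ allᵇ-map (suc N ∸_) (values N) (λ k → countVal k T ≡ᵇ 1) ⟨
    allᵇ (λ k → countVal k T ≡ᵇ 1) (map (suc N ∸_) (values N)) ≡⟨ allᵇ-↭ (λ k → countVal k T ≡ᵇ 1) (values-complement-↭ N) ⟩
    allᵇ (λ k → countVal k T ≡ᵇ 1) (values N)                  ∎
    where
    open ≡-Reasoning
    countVal-Φ : ∀ k → k ∈ values N → countVal k (map Φ T) ≡ countVal (suc N ∸ k) T
    countVal-Φ k k∈ = trans (∑-map Φ T (λ q → 𝟙 (proj₂ q ≡ᵇ k)))
      (∑-cong T (λ p p∈ → cong 𝟙 (∸-≡ᵇ (suc N) (proj₂ p) k (≤1+N p∈) (m≤n⇒m≤1+n (proj₂ (∈-values⁻ N k∈))))))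

  increasing-antiautomorphism : (∀ a b → a ∈ cs → b ∈ cs → φ a ≺ φ b ≡ b ≺ a) →
    increasing (relabel φ (complement N T)) ≡ increasing T
  increasing-antiautomorphism φ-≺ rewrite Φ-≡ = begin
    allᵇ (λ p → allᵇ (pairOK p) (map Φ T)) (map Φ T)    ≡⟨ allᵇ-map Φ T (λ p → allᵇ (pairOK p) (map Φ T)) ⟩
    allᵇ (λ p → allᵇ (pairOK (Φ p)) (map Φ T)) T        ≡⟨ allᵇ-ext T (λ p → allᵇ-map Φ T (pairOK (Φ p))) ⟩
    allᵇ (λ p → allᵇ (λ q → pairOK (Φ p) (Φ q)) T) T    ≡⟨ allᵇ-cong T (λ p p∈ → allᵇ-cong T (λ q q∈ → pairOK-Φ p∈ q∈)) ⟩
    allᵇ (λ p → allᵇ (λ q → pairOK q p) T) T            ≡⟨ allᵇ-comm T T (λ p q → pairOK q p) ⟩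
    allᵇ (λ q → allᵇ (pairOK q) T) T                    ∎
    where
    open ≡-Reasoning
    pairOK-Φ : ∀ {p q} → p ∈ T → q ∈ T → pairOK (Φ p) (Φ q) ≡ pairOK q p
    pairOK-Φ {a , v} {b , v′} p∈ q∈ = begin
      pairOK (φ a , suc N ∸ v) (φ b , suc N ∸ v′)   ≡⟨ pairOK-≺ (φ a) (φ b) (suc N ∸ v) (suc N ∸ v′) ⟩
      not (φ a ≺ φ b) ∨ (suc N ∸ v <ᵇ suc N ∸ v′)   ≡⟨ cong₂ (λ x z → not x ∨ z) (φ-≺ a b (FillingOf-cell T∈ p∈) (FillingOf-cell T∈ q∈))
                                                                                (∸-<ᵇ (suc N) v v′ (≤1+N p∈)) ⟩
      not (b ≺ a) ∨ (v′ <ᵇ v)                       ≡⟨ pairOK-≺ b a v′ v ⟨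
      pairOK (b , v′) (a , v)                       ∎

∑-entry-antiautomorphism : ∀ (φ : Cell → Cell) cs N y →
  map φ cs ↭ cs →
  (∀ a b → a ∈ cs → b ∈ cs → φ a ≺ φ b ≡ b ≺ a) →
  (∀ c → c ∈ cs → (φ c ≡ᶜ y) ≡ (c ≡ᶜ y)) →
  multiplicity y cs ≡ 1 →
  ∑ (allFillings cs N) (onSYT N (entry y)) ≡ ∑ (allFillings cs N) (onSYT N (λ T → suc N ∸ entry y T))
∑-entry-antiautomorphism φ cs N y φ-↭ φ-≺ φ-y y-simple = begin
  ∑ (allFillings cs N) g                                 ≡⟨ ∑-allFillings-↭ N φ-↭ g g-↭ ⟨
  ∑ (allFillings (map φ cs) N) g                         ≡⟨ ∑-allFillings-map φ cs N g ⟩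
  ∑ (allFillings cs N) (g ∘ relabel φ)                   ≡⟨ ∑-allFillings-complement cs N (g ∘ relabel φ) ⟩
  ∑ (allFillings cs N) (g ∘ relabel φ ∘ complement N)    ≡⟨ ∑-allFillings-cong cs N pointwise ⟩
  ∑ (allFillings cs N) (onSYT N (λ T → suc N ∸ entry y T)) ∎
  where
  open ≡-Reasoning
  g : Filling → ℕ
  g = onSYT N (entry y)
  g-↭ : PermutationInvariant g
  g-↭ p = cong₂ (λ b x → if b then x else 0) (isSYT-↭ N p) (entry-↭ y p)
  pointwise : ∀ T → FillingOf N cs T → g (relabel φ (complement N T)) ≡ onSYT N (λ T → suc N ∸ entry y T) T
  pointwise T T∈ = cong₂ (λ b x → if b then x else 0)
    (cong₂ _∧_ (usesEachOnce-antiautomorphism φ T∈) (increasing-antiautomorphism φ T∈ φ-≺))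
    (entry-antiautomorphism φ T∈ y φ-y y-simple)

∑-entry-relabel : ∀ (ψ : Cell → Cell) cs N y →
  (∀ a b → ψ a ≺ ψ b ≡ a ≺ b) → (∀ c → (ψ c ≡ᶜ ψ y) ≡ (c ≡ᶜ y)) →
  ∑ (allFillings (map ψ cs) N) (onSYT N (entry (ψ y))) ≡ ∑ (allFillings cs N) (onSYT N (entry y))
∑-entry-relabel ψ cs N y ψ-≺ ψ-≡ᶜ = trans (∑-allFillings-map ψ cs N _)
  (∑-ext (allFillings cs N) (λ T → cong₂ (λ b x → if b then x else 0) (isSYT-relabel ψ ψ-≺ N T)
    (trans (∑-map (λ p → (ψ (proj₁ p) , proj₂ p)) T (λ p → if proj₁ p ≡ᶜ ψ y then proj₂ p else 0))
           (∑-ext T (λ p → cong (λ b → if b then proj₂ p else 0) (ψ-≡ᶜ (proj₁ p)))))))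

multiplicity-map : ∀ (ψ : Cell → Cell) cs y → (∀ c → (ψ c ≡ᶜ ψ y) ≡ (c ≡ᶜ y)) →
  multiplicity (ψ y) (map ψ cs) ≡ multiplicity y cs
multiplicity-map ψ cs y ψ-≡ᶜ = trans (∑-map ψ cs (λ c → 𝟙 (c ≡ᶜ ψ y))) (∑-ext cs (cong 𝟙 ∘ ψ-≡ᶜ))

-- Adding a cell

skipEntries : ℕ → Filling → Filling
skipEntries k = map (λ p → (proj₁ p , skip k (proj₂ p)))

HasEntry : ℕ → Filling → Set
HasEntry k = Any (λ p → proj₂ p ≡ k)

-- A filling with entries in 1, …, N+1 avoiding k is skipEntries k of exactly one filling with entries in 1, …, N.
∑-allFillings-skip : ∀ cs N k → 1 ≤ k → k ≤ suc N → (G : Filling → ℕ) → (∀ T → HasEntry k T → G T ≡ 0) →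
  ∑ (allFillings cs (suc N)) G ≡ ∑ (allFillings cs N) (G ∘ skipEntries k)
∑-allFillings-skip []       N k 1≤k k≤1+N G G-k = refl
∑-allFillings-skip (c ∷ cs) N k 1≤k k≤1+N G G-k = begin
  ∑ (allFillings (c ∷ cs) (suc N)) G            ≡⟨ ∑-allFillings-∷ c cs (suc N) G ⟩
  ∑ (values (suc N)) H                          ≡⟨ ∑-↭ H (values-split N k 1≤k k≤1+N) ⟩
  H k + ∑ (map (skip k) (values N)) H           ≡⟨ cong₂ _+_ (∑-zero (allFillings cs (suc N)) (λ T _ → G-k _ (here refl)))
                                                             (∑-map (skip k) (values N) H) ⟩
  ∑ (values N) (H ∘ skip k)                     ≡⟨ ∑-ext (values N) (λ v → ∑-allFillings-skip cs N k 1≤k k≤1+N _ (λ T → G-k _ ∘ there)) ⟩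
  ∑ (values N) (λ v → ∑ (allFillings cs N) (λ T → G ((c , skip k v) ∷ skipEntries k T)))
                                                ≡⟨ ∑-allFillings-∷ c cs N (G ∘ skipEntries k) ⟨
  ∑ (allFillings (c ∷ cs) N) (G ∘ skipEntries k) ∎
  where
  open ≡-Reasoning
  H : ℕ → ℕ
  H v = ∑ (allFillings cs (suc N)) (λ T → G ((c , v) ∷ T))

compatible : Cell × ℕ → Filling → Bool
compatible p L = allᵇ (pairOK p) L ∧ allᵇ (λ q → pairOK q p) L

increasing-∷ : ∀ p L → increasing (p ∷ L) ≡ (pairOK p p ∧ compatible p L) ∧ increasing L
increasing-∷ p L = begin
  (pairOK p p ∧ allᵇ (pairOK p) L) ∧ allᵇ (λ q → pairOK q p ∧ allᵇ (pairOK q) L) L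
    ≡⟨ cong ((pairOK p p ∧ allᵇ (pairOK p) L) ∧_) (allᵇ-∧ L (λ q → pairOK q p) (λ q → allᵇ (pairOK q) L)) ⟩
  (pairOK p p ∧ p≤L) ∧ (L≤p ∧ increasing L) ≡⟨ ∧-assoc (pairOK p p) p≤L _ ⟩
  pairOK p p ∧ (p≤L ∧ (L≤p ∧ increasing L)) ≡⟨ cong (pairOK p p ∧_) (∧-assoc p≤L L≤p (increasing L)) ⟨
  pairOK p p ∧ ((p≤L ∧ L≤p) ∧ increasing L) ≡⟨ ∧-assoc (pairOK p p) (p≤L ∧ L≤p) (increasing L) ⟨
  (pairOK p p ∧ (p≤L ∧ L≤p)) ∧ increasing L ∎
  where
  open ≡-Reasoning
  p≤L = allᵇ (pairOK p) L
  L≤p = allᵇ (λ q → pairOK q p) L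

increasing-mapEntries : ∀ (σ : ℕ → ℕ) → (∀ v j → (σ v <ᵇ σ j) ≡ (v <ᵇ j)) →
  ∀ T → increasing (map (λ p → (proj₁ p , σ (proj₂ p))) T) ≡ increasing T
increasing-mapEntries σ σ-< T = trans (allᵇ-map Ψ T (λ p → allᵇ (pairOK p) (map Ψ T)))
  (allᵇ-ext T (λ p → trans (allᵇ-map Ψ T (pairOK (Ψ p))) (allᵇ-ext T (λ q → pairOK-σ p q))))
  where
  Ψ : Cell × ℕ → Cell × ℕ
  Ψ (c , v) = (c , σ v)
  pairOK-σ : ∀ p q → pairOK (Ψ p) (Ψ q) ≡ pairOK p q
  pairOK-σ (a , v) (b , v′) rewrite pairOK-≺ a b (σ v) (σ v′) | σ-< v v′ = sym (pairOK-≺ a b v v′)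

countVal-HasEntry : ∀ k T → HasEntry k T → ∃[ c ] countVal k T ≡ suc c
countVal-HasEntry k ((c , v) ∷ T) (here refl) rewrite ≡ᵇ-refl v = countVal v T , refl
countVal-HasEntry k ((c , v) ∷ T) (there h) with countVal-HasEntry k T h
... | n , e = 𝟙 (v ≡ᵇ k) + n , trans (cong (𝟙 (v ≡ᵇ k) +_) e) (+-suc (𝟙 (v ≡ᵇ k)) n)

usesEachOnce-insert : ∀ x N k T → 1 ≤ k → k ≤ suc N →
  usesEachOnce (suc N) ((x , k) ∷ skipEntries k T) ≡ usesEachOnce N T
usesEachOnce-insert x N k T 1≤k k≤1+N = begin
  allᵇ P (values (suc N))                        ≡⟨ allᵇ-↭ P (values-split N k 1≤k k≤1+N) ⟩
  P k ∧ allᵇ P (map (skip k) (values N))         ≡⟨ cong₂ _∧_ k-once (allᵇ-map (skip k) (values N) P) ⟩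
  true ∧ allᵇ (P ∘ skip k) (values N)            ≡⟨ allᵇ-ext (values N) j-once ⟩
  allᵇ (λ j → countVal j T ≡ᵇ 1) (values N)      ∎
  where
  open ≡-Reasoning
  Ψ : Cell × ℕ → Cell × ℕ
  Ψ (c , v) = (c , skip k v)
  P : ℕ → Bool
  P j = countVal j ((x , k) ∷ skipEntries k T) ≡ᵇ 1
  countVal-skip : ∀ j → countVal j (skipEntries k T) ≡ ∑ T (λ p → 𝟙 (skip k (proj₂ p) ≡ᵇ j))
  countVal-skip j = ∑-map Ψ T (λ q → 𝟙 (proj₂ q ≡ᵇ j))
  k-once : P k ≡ true
  k-once rewrite ≡ᵇ-refl k | countVal-skip k | ∑-zero T {g = λ p → 𝟙 (skip k (proj₂ p) ≡ᵇ k)} (λ p _ → cong 𝟙 (skip-≢ k (proj₂ p))) = refl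
  j-once : ∀ j → P (skip k j) ≡ (countVal j T ≡ᵇ 1)
  j-once j rewrite trans (≡ᵇ-sym k (skip k j)) (skip-≢ k j) | countVal-skip (skip k j) =
    cong (_≡ᵇ 1) (∑-ext T (λ p → cong 𝟙 (skip-≡ᵇ k (proj₂ p) j)))

isSYT-insert : ∀ x N k T → 1 ≤ k → k ≤ suc N →
  isSYT (suc N) ((x , k) ∷ skipEntries k T) ≡ isSYT N T ∧ compatible (x , k) (skipEntries k T)
isSYT-insert x N k T 1≤k k≤1+N = begin
  usesEachOnce (suc N) ((x , k) ∷ L) ∧ increasing ((x , k) ∷ L)
    ≡⟨ cong₂ _∧_ (usesEachOnce-insert x N k T 1≤k k≤1+N) (increasing-∷ (x , k) L) ⟩
  usesEachOnce N T ∧ ((pairOK (x , k) (x , k) ∧ C) ∧ increasing L)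
    ≡⟨ cong (λ b → usesEachOnce N T ∧ ((b ∧ C) ∧ increasing L)) (pairOK-refl x k) ⟩
  usesEachOnce N T ∧ (C ∧ increasing L)
    ≡⟨ cong (λ b → usesEachOnce N T ∧ (C ∧ b)) (increasing-mapEntries (skip k) (skip-<ᵇ k) T) ⟩
  usesEachOnce N T ∧ (C ∧ increasing T) ≡⟨ ∧.x∙yz≈xz∙y (usesEachOnce N T) C (increasing T) ⟩
  isSYT N T ∧ C ∎
  where
  open ≡-Reasoning
  L = skipEntries k T
  C = compatible (x , k) L

#SYT-∷ : ∀ x cs N →
  #SYT (x ∷ cs) (suc N) ≡ ∑ (values (suc N)) (λ k → ∑ (allFillings cs N) (λ T → 𝟙 (isSYT N T ∧ compatible (x , k) (skipEntries k T))))
#SYT-∷ x cs N = trans (∑-allFillings-∷ x cs (suc N) (𝟙 ∘ isSYT (suc N)))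
  (∑-cong (values (suc N)) (λ k k∈ → let (1≤k , k≤1+N) = ∈-values⁻ (suc N) k∈ in
    trans (∑-allFillings-skip cs N k 1≤k k≤1+N _ (λ T → repeated k T k∈))
          (∑-ext (allFillings cs N) (λ T → cong 𝟙 (isSYT-insert x N k T 1≤k k≤1+N)))))
  where
  repeated : ∀ k T → k ∈ values (suc N) → HasEntry k T → 𝟙 (isSYT (suc N) ((x , k) ∷ T)) ≡ 0
  repeated k T k∈ h with countVal-HasEntry k T h
  ... | n , e = cong (λ b → 𝟙 (b ∧ _)) (allᵇ-false (values (suc N)) (λ j → countVal j ((x , k) ∷ T) ≡ᵇ 1) k∈
                  (trans (cong (λ c → (𝟙 (k ≡ᵇ k) + c) ≡ᵇ 1) e) (cong (λ b → (𝟙 b + suc n) ≡ᵇ 1) (≡ᵇ-refl k))))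

record JustBefore (x w : Cell) (cs : List Cell) : Set where
  field
    nothing-before : ∀ c → c ∈ cs → c ≺ x ≡ false
    only-via-w     : ∀ c → c ∈ cs → x ≺ c ≡ true → c ≡ w ⊎ w ≺ c ≡ true
    x≺w            : x ≺ w ≡ true
    w-simple       : multiplicity w cs ≡ 1

record JustAfter (z u : Cell) (cs : List Cell) : Set where
  field
    nothing-after : ∀ c → c ∈ cs → z ≺ c ≡ false
    only-via-u    : ∀ c → c ∈ cs → c ≺ z ≡ true → c ≡ u ⊎ c ≺ u ≡ true
    u≺z           : u ≺ z ≡ true
    u-simple      : multiplicity u cs ≡ 1

module _ {N cs T} (T∈ : FillingOf N cs T) (T-inc : increasing T ≡ true) (k : ℕ) where

  private
    Ψ : Cell × ℕ → Cell × ℕ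
    Ψ (c , v) = (c , skip k v)

  compatible-JustBefore : ∀ {x w} → JustBefore x w cs →
    compatible (x , k) (skipEntries k T) ≡ (k <ᵇ suc (entry w T))
  compatible-JustBefore {x} {w} jb = begin
    allᵇ (pairOK (x , k)) (map Ψ T) ∧ allᵇ (λ q → pairOK q (x , k)) (map Ψ T)
      ≡⟨ cong₂ _∧_ (allᵇ-map Ψ T (pairOK (x , k))) (allᵇ-map Ψ T (λ q → pairOK q (x , k))) ⟩
    allᵇ (pairOK (x , k) ∘ Ψ) T ∧ allᵇ (λ q → pairOK (Ψ q) (x , k)) T ≡⟨ cong₂ _∧_ x-first x-source ⟩
    (k <ᵇ suc (entry w T)) ∧ true ≡⟨ ∧-identityʳ _ ⟩
    k <ᵇ suc (entry w T) ∎
    where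
    open ≡-Reasoning
    open JustBefore jb
    w∈ = entry-∈ w T∈ w-simple
    x-source : allᵇ (λ q → pairOK (Ψ q) (x , k)) T ≡ true
    x-source = allᵇ-intro T _ (λ p p∈ → trans (pairOK-≺ (proj₁ p) x (skip k (proj₂ p)) k)
      (cong (λ b → not b ∨ (skip k (proj₂ p) <ᵇ k)) (nothing-before _ (FillingOf-cell T∈ p∈))))
    x-first : allᵇ (pairOK (x , k) ∘ Ψ) T ≡ (k <ᵇ suc (entry w T))
    x-first with k <ᵇ suc (entry w T) in k≤w
    ... | false = allᵇ-false T _ w∈ (trans (pairOK-≺ x w k (skip k (entry w T)))
                    (trans (cong₂ (λ a b → not a ∨ b) x≺w (<ᵇ-skip k (entry w T))) k≤w))
    ... | true  = allᵇ-intro T _ (λ p p∈ → trans (pairOK-≺ x (proj₁ p) k (skip k (proj₂ p)))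
                    (trans (cong (λ b → not (x ≺ proj₁ p) ∨ b) (<ᵇ-skip k (proj₂ p))) (below p p∈)))
      where
      below : ∀ p → p ∈ T → not (x ≺ proj₁ p) ∨ (k <ᵇ suc (proj₂ p)) ≡ true
      below (c , v) p∈ with x ≺ c in x≺c
      ... | false = refl
      ... | true with only-via-w c (FillingOf-cell T∈ p∈) x≺c
      ...   | inj₁ refl = subst (λ v → (k <ᵇ suc v) ≡ true) (sym (entry-unique w T∈ w-simple p∈)) k≤w
      ...   | inj₂ w≺c  = <ᵇ-true k (suc v) (≤-trans (<ᵇ-true⁻ k (suc (entry w T)) k≤w) (m≤n⇒m≤1+n w<v))
        where
        w<v = <ᵇ-true⁻ (entry w T) v (∨-true⁻ (w ≺ c) _
                (trans (sym (pairOK-≺ w c (entry w T) v)) (increasing-∈ T-inc w∈ p∈)) w≺c)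

  compatible-JustAfter : ∀ {z u} → JustAfter z u cs →
    compatible (z , k) (skipEntries k T) ≡ (entry u T <ᵇ k)
  compatible-JustAfter {z} {u} ja = begin
    allᵇ (pairOK (z , k)) (map Ψ T) ∧ allᵇ (λ q → pairOK q (z , k)) (map Ψ T)
      ≡⟨ cong₂ _∧_ (allᵇ-map Ψ T (pairOK (z , k))) (allᵇ-map Ψ T (λ q → pairOK q (z , k))) ⟩
    allᵇ (pairOK (z , k) ∘ Ψ) T ∧ allᵇ (λ q → pairOK (Ψ q) (z , k)) T ≡⟨ cong₂ _∧_ z-sink z-last ⟩
    true ∧ (entry u T <ᵇ k) ∎
    where
    open ≡-Reasoning
    open JustAfter ja
    u∈ = entry-∈ u T∈ u-simple
    z-sink : allᵇ (pairOK (z , k) ∘ Ψ) T ≡ true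
    z-sink = allᵇ-intro T _ (λ p p∈ → trans (pairOK-≺ z (proj₁ p) k (skip k (proj₂ p)))
      (cong (λ b → not b ∨ (k <ᵇ skip k (proj₂ p))) (nothing-after _ (FillingOf-cell T∈ p∈))))
    z-last : allᵇ (λ q → pairOK (Ψ q) (z , k)) T ≡ (entry u T <ᵇ k)
    z-last with entry u T <ᵇ k in u<k
    ... | false = allᵇ-false T _ u∈ (trans (pairOK-≺ u z (skip k (entry u T)) k)
                    (trans (cong₂ (λ a b → not a ∨ b) u≺z (skip-<ᵇ-self k (entry u T))) u<k))
    ... | true  = allᵇ-intro T _ (λ p p∈ → trans (pairOK-≺ (proj₁ p) z (skip k (proj₂ p)) k)
                    (trans (cong (λ b → not (proj₁ p ≺ z) ∨ b) (skip-<ᵇ-self k (proj₂ p))) (above p p∈)))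
      where
      above : ∀ p → p ∈ T → not (proj₁ p ≺ z) ∨ (proj₂ p <ᵇ k) ≡ true
      above (c , v) p∈ with c ≺ z in c≺z
      ... | false = refl
      ... | true with only-via-u c (FillingOf-cell T∈ p∈) c≺z
      ...   | inj₁ refl = subst (λ v → (v <ᵇ k) ≡ true) (sym (entry-unique u T∈ u-simple p∈)) u<k
      ...   | inj₂ c≺u  = <ᵇ-true v k (<-trans v<u (<ᵇ-true⁻ (entry u T) k u<k))
        where
        v<u = <ᵇ-true⁻ v (entry u T) (∨-true⁻ (c ≺ u) _
                (trans (sym (pairOK-≺ c u v (entry u T))) (increasing-∈ T-inc p∈ u∈)) c≺u)

#SYT-∷-counting : ∀ x cs N (t : ℕ → Filling → Bool) (h : Filling → ℕ) →
  (∀ k T → FillingOf N cs T → increasing T ≡ true → compatible (x , k) (skipEntries k T) ≡ t k T) →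
  (∀ T → FillingOf N cs T → ∑ (values (suc N)) (λ k → 𝟙 (t k T)) ≡ h T) →
  #SYT (x ∷ cs) (suc N) ≡ ∑ (allFillings cs N) (onSYT N h)
#SYT-∷-counting x cs N t h compatible≡t count≡h = begin
  #SYT (x ∷ cs) (suc N) ≡⟨ #SYT-∷ x cs N ⟩
  ∑ (values (suc N)) (λ k → ∑ (allFillings cs N) (λ T → 𝟙 (isSYT N T ∧ compatible (x , k) (skipEntries k T))))
    ≡⟨ ∑-ext (values (suc N)) (λ k → ∑-allFillings-cong cs N (by-threshold k)) ⟩
  ∑ (values (suc N)) (λ k → ∑ (allFillings cs N) (λ T → 𝟙 (isSYT N T ∧ t k T)))
    ≡⟨ ∑-comm (values (suc N)) (allFillings cs N) _ ⟩
  ∑ (allFillings cs N) (λ T → ∑ (values (suc N)) (λ k → 𝟙 (isSYT N T ∧ t k T)))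
    ≡⟨ ∑-allFillings-cong cs N counted ⟩
  ∑ (allFillings cs N) (onSYT N h) ∎
  where
  open ≡-Reasoning
  by-threshold : ∀ k T → FillingOf N cs T →
    𝟙 (isSYT N T ∧ compatible (x , k) (skipEntries k T)) ≡ 𝟙 (isSYT N T ∧ t k T)
  by-threshold k T T∈ with isSYT N T in syt
  ... | false = refl
  ... | true  = cong 𝟙 (compatible≡t k T T∈ (∧-true⁻ʳ (usesEachOnce N T) _ syt))
    where
    ∧-true⁻ʳ : ∀ a b → a ∧ b ≡ true → b ≡ true
    ∧-true⁻ʳ true b e = e
  counted : ∀ T → FillingOf N cs T → ∑ (values (suc N)) (λ k → 𝟙 (isSYT N T ∧ t k T)) ≡ onSYT N h T
  counted T T∈ with isSYT N T
  ... | false = ∑-zero (values (suc N)) (λ _ _ → refl)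
  ... | true  = count≡h T T∈

#SYT-JustBefore : ∀ {x w cs} N → JustBefore x w cs →
  #SYT (x ∷ cs) (suc N) ≡ ∑ (allFillings cs N) (onSYT N (entry w))
#SYT-JustBefore {x} {w} {cs} N jb = #SYT-∷-counting x cs N (λ k T → k <ᵇ suc (entry w T)) (entry w)
  (λ k T T∈ T-inc → compatible-JustBefore T∈ T-inc k jb)
  (λ T T∈ → count-values-≤ (suc N) (entry w T)
              (m≤n⇒m≤1+n (proj₂ (FillingOf-entry T∈ (entry-∈ w T∈ (JustBefore.w-simple jb))))))

#SYT-JustAfter : ∀ {z u cs} N → JustAfter z u cs →
  #SYT (z ∷ cs) (suc N) ≡ ∑ (allFillings cs N) (onSYT N (λ T → suc N ∸ entry u T))
#SYT-JustAfter {z} {u} {cs} N ja = #SYT-∷-counting z cs N (λ k T → entry u T <ᵇ k) (λ T → suc N ∸ entry u T)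
  (λ k T T∈ T-inc → compatible-JustAfter T∈ T-inc k ja)
  (λ T T∈ → count-values-> (suc N) (entry u T)
              (m≤n⇒m≤1+n (proj₂ (FillingOf-entry T∈ (entry-∈ u T∈ (JustAfter.u-simple ja))))))

down : Cell → Cell
down (i , j) = (suc i , j)

right : Cell → Cell
right (i , j) = (i , suc j)

down-≺ : ∀ a b → down a ≺ down b ≡ a ≺ b
down-≺ (i , j) (i′ , j′) = refl

right-≺ : ∀ a b → right a ≺ right b ≡ a ≺ b
right-≺ (i , j) (i′ , j′) = refl

down-≡ᶜ : ∀ c y → (down c ≡ᶜ down y) ≡ (c ≡ᶜ y)
down-≡ᶜ (i , j) (i′ , j′) = refl

right-≡ᶜ : ∀ c y → (right c ≡ᶜ right y) ≡ (c ≡ᶜ y)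
right-≡ᶜ (i , j) (i′ , j′) = refl

dec-suc : ∀ a b → b ≤ suc a → dec (suc a) b ≡ suc a ∷ dec a b
dec-suc a b b≤1+a rewrite +-∸-assoc 1 b≤1+a =
  cong (suc a ∷_) (trans (map-applyUpTo suc (suc a ∸_) (suc a ∸ b)) (sym (map-applyUpTo id (a ∸_) (suc a ∸ b))))

dec-∷ʳ : ∀ a b → b ≤ a → dec a b ≡ dec a (suc b) ++ [ b ]
dec-∷ʳ a b b≤a rewrite +-∸-assoc 1 b≤a = begin
  map (a ∸_) (upTo (suc (a ∸ b)))                   ≡⟨ cong (map (a ∸_)) (upTo-∷ʳ (a ∸ b)) ⟨
  map (a ∸_) (upTo (a ∸ b) ++ [ a ∸ b ])            ≡⟨ map-++ (a ∸_) (upTo (a ∸ b)) [ a ∸ b ] ⟩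
  map (a ∸_) (upTo (a ∸ b)) ++ [ a ∸ (a ∸ b) ]      ≡⟨ cong (λ c → map (a ∸_) (upTo (a ∸ b)) ++ [ c ]) (m∸[m∸n]≡n b≤a) ⟩
  map (a ∸_) (upTo (a ∸ b)) ++ [ b ]                ∎
  where open ≡-Reasoning

dec-map-suc : ∀ a b → dec (suc a) (suc b) ≡ map suc (dec a b)
dec-map-suc a b = trans (map-cong-local (All.tabulate (λ i∈ → +-∸-assoc 1 (i≤a i∈)))) (map-∘ (upTo (suc a ∸ b)))
  where
  i≤a : ∀ {i} → i ∈ upTo (suc a ∸ b) → i ≤ a
  i≤a i∈ = ≤-pred (≤-trans (∈-upTo⁻ i∈) (m∸n≤m (suc a) b))

length-dec : ∀ a b → length (dec a b) ≡ suc a ∸ b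
length-dec a b = trans (length-map (a ∸_) (upTo (suc a ∸ b))) (length-upTo (suc a ∸ b))

length-range : ∀ u l → length (range u l) ≡ l ∸ u
length-range u l = trans (length-map (u +_) (upTo (l ∸ u))) (length-upTo (l ∸ u))

cellsFrom-suc : ∀ i L M → cellsFrom (suc i) L M ≡ map down (cellsFrom i L M)
cellsFrom-suc i []      M       = refl
cellsFrom-suc i (l ∷ L) []      = trans (cong₂ _++_ (map-∘ (range 0 l)) (cellsFrom-suc (suc i) L []))
  (sym (map-++ down (map (i ,_) (range 0 l)) (cellsFrom (suc i) L [])))
cellsFrom-suc i (l ∷ L) (u ∷ M) = trans (cong₂ _++_ (map-∘ (range u l)) (cellsFrom-suc (suc i) L M))
  (sym (map-++ down (map (i ,_) (range u l)) (cellsFrom (suc i) L M)))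

cellsFrom-∷ʳ : ∀ i L M a b → length L ≡ length M →
  cellsFrom i (L ++ [ a ]) (M ++ [ b ]) ≡ cellsFrom i L M ++ map ((i + length L) ,_) (range b a)
cellsFrom-∷ʳ i []      []      a b e rewrite +-identityʳ i = ++-identityʳ _
cellsFrom-∷ʳ i (l ∷ L) (u ∷ M) a b e = begin
  row ++ cellsFrom (suc i) (L ++ [ a ]) (M ++ [ b ])            ≡⟨ cong (row ++_) (cellsFrom-∷ʳ (suc i) L M a b (suc-injective e)) ⟩
  row ++ (cellsFrom (suc i) L M ++ map (suc i + length L ,_) (range b a))
    ≡⟨ ++-assoc row (cellsFrom (suc i) L M) _ ⟨
  (row ++ cellsFrom (suc i) L M) ++ map (suc i + length L ,_) (range b a)
    ≡⟨ cong (λ r → (row ++ cellsFrom (suc i) L M) ++ map (r ,_) (range b a)) (+-suc i (length L)) ⟨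
  (row ++ cellsFrom (suc i) L M) ++ map (i + suc (length L) ,_) (range b a) ∎
  where
  open ≡-Reasoning
  row = map (i ,_) (range u l)

cellsFrom-map-suc : ∀ i L M → length L ≡ length M → cellsFrom i (map suc L) (map suc M) ≡ map right (cellsFrom i L M)
cellsFrom-map-suc i []      []      e = refl
cellsFrom-map-suc i (l ∷ L) (u ∷ M) e = trans (cong₂ _++_ row (cellsFrom-map-suc (suc i) L M (suc-injective e)))
  (sym (map-++ right (map (i ,_) (range u l)) (cellsFrom (suc i) L M)))
  where
  X = upTo (l ∸ u)
  row : map (i ,_) (range (suc u) (suc l)) ≡ map right (map (i ,_) (range u l))
  row = trans (sym (map-∘ {g = i ,_} {f = suc u +_} X))
    (trans (map-∘ {g = right} {f = λ x → (i , u + x)} X) (cong (map right) (map-∘ {g = i ,_} {f = u +_} X)))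

-- Out-of-range rows have length 0, matching the padding of inner shapes in cellsFrom.
_!_ : List ℕ → ℕ → ℕ
[]       ! r     = 0
(x ∷ xs) ! zero  = x
(x ∷ xs) ! suc r = xs ! r

∈-range⁻ : ∀ u l {j} → j ∈ range u l → u ≤ j × j < l
∈-range⁻ u l j∈ with ∈-map⁻ (u +_) j∈
... | t , t∈ , refl = m≤m+n u t , subst (u + t <_) (m+[n∸m]≡n u≤l) (+-monoʳ-< u t<l∸u)
  where
  t<l∸u = ∈-upTo⁻ t∈
  u≤l : u ≤ l
  u≤l = ≮⇒≥ (λ l<u → n≮0 (<-≤-trans t<l∸u (≤-reflexive (m≤n⇒m∸n≡0 (<⇒≤ l<u)))))

∈-range⁺ : ∀ u l {j} → u ≤ j → j < l → j ∈ range u l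
∈-range⁺ u l {j} u≤j j<l = subst (_∈ range u l) (m+[n∸m]≡n u≤j) (∈-map⁺ (u +_) (∈-upTo⁺ (∸-monoˡ-< j<l u≤j)))

∈-row⁻ : ∀ i (X : List ℕ) {c : Cell} → c ∈ map (i ,_) X → proj₁ c ≡ i × proj₂ c ∈ X
∈-row⁻ i X c∈ with ∈-map⁻ (i ,_) c∈
... | x , x∈ , refl = refl , x∈

∈-firstRow⁻ : ∀ i₀ u l {i j} → (i , j) ∈ map (i₀ ,_) (range u l) → i ≡ i₀ + 0 × u ≤ j × j < l
∈-firstRow⁻ i₀ u l c∈ = let (i≡i₀ , j∈) = ∈-row⁻ i₀ (range u l) c∈ in
  trans i≡i₀ (sym (+-identityʳ i₀)) , ∈-range⁻ u l j∈

∈-cellsFrom⁻ : ∀ i₀ L M {i j} → (i , j) ∈ cellsFrom i₀ L M →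
  Σ ℕ (λ r → i ≡ i₀ + r × r < length L × M ! r ≤ j × j < L ! r)
∈-cellsFrom⁻ i₀ (l ∷ L) [] c∈ with ∈-++⁻ (map (i₀ ,_) (range 0 l)) c∈
... | inj₁ c∈row  = let (e , _ , j<l) = ∈-firstRow⁻ i₀ 0 l c∈row in 0 , e , s≤s z≤n , z≤n , j<l
... | inj₂ c∈rest = let (r , e , r<L , _ , j<) = ∈-cellsFrom⁻ (suc i₀) L [] c∈rest in
                    suc r , trans e (sym (+-suc i₀ r)) , s≤s r<L , z≤n , j<
∈-cellsFrom⁻ i₀ (l ∷ L) (u ∷ M) c∈ with ∈-++⁻ (map (i₀ ,_) (range u l)) c∈
... | inj₁ c∈row  = let (e , u≤j , j<l) = ∈-firstRow⁻ i₀ u l c∈row in 0 , e , s≤s z≤n , u≤j , j<l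
... | inj₂ c∈rest = let (r , e , r<L , ≤j , j<) = ∈-cellsFrom⁻ (suc i₀) L M c∈rest in
                    suc r , trans e (sym (+-suc i₀ r)) , s≤s r<L , ≤j , j<

∈-cellsFrom⁺ : ∀ i₀ L M r {j} → r < length L → M ! r ≤ j → j < L ! r → (i₀ + r , j) ∈ cellsFrom i₀ L M
∈-cellsFrom⁺ i₀ (l ∷ L) []      zero    r<L      _   j<l rewrite +-identityʳ i₀ =
  ∈-++⁺ˡ (∈-map⁺ (i₀ ,_) (∈-range⁺ 0 l z≤n j<l))
∈-cellsFrom⁺ i₀ (l ∷ L) []      (suc r) (s≤s r<L) _   j<  rewrite +-suc i₀ r =
  ∈-++⁺ʳ (map (i₀ ,_) (range 0 l)) (∈-cellsFrom⁺ (suc i₀) L [] r r<L z≤n j<)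
∈-cellsFrom⁺ i₀ (l ∷ L) (u ∷ M) zero    r<L      u≤j j<l rewrite +-identityʳ i₀ =
  ∈-++⁺ˡ (∈-map⁺ (i₀ ,_) (∈-range⁺ u l u≤j j<l))
∈-cellsFrom⁺ i₀ (l ∷ L) (u ∷ M) (suc r) (s≤s r<L) ≤j  j<  rewrite +-suc i₀ r =
  ∈-++⁺ʳ (map (i₀ ,_) (range u l)) (∈-cellsFrom⁺ (suc i₀) L M r r<L ≤j j<)

cellsFrom-rows : ∀ i₀ L M {c} → c ∈ cellsFrom i₀ L M → i₀ ≤ proj₁ c × proj₁ c < i₀ + length L
cellsFrom-rows i₀ L M {i , j} c∈ with ∈-cellsFrom⁻ i₀ L M c∈
... | r , refl , r<L , _ = m≤m+n i₀ r , +-monoʳ-< i₀ r<L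

row-unique : ∀ (i : ℕ) u l → Unique (map (i ,_) (range u l))
row-unique i u l = Unique.map⁺ (cong proj₂) (Unique.map⁺ (+-cancelˡ-≡ u _ _) (Unique.upTo⁺ (l ∸ u)))

row-disjoint : ∀ i u l L M {c : Cell} → c ∈ map (i ,_) (range u l) × c ∈ cellsFrom (suc i) L M → ⊥
row-disjoint i u l L M (c∈row , c∈rest) =
  <-irrefl (sym (proj₁ (∈-row⁻ i (range u l) c∈row))) (proj₁ (cellsFrom-rows (suc i) L M c∈rest))

cellsFrom-unique : ∀ i L M → Unique (cellsFrom i L M)
cellsFrom-unique i []      M       = AllPairs.[]
cellsFrom-unique i (l ∷ L) []      = Unique.++⁺ (row-unique i 0 l) (cellsFrom-unique (suc i) L []) (row-disjoint i 0 l L [])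
cellsFrom-unique i (l ∷ L) (u ∷ M) = Unique.++⁺ (row-unique i u l) (cellsFrom-unique (suc i) L M) (row-disjoint i u l L M)

involution-↭ : ∀ (f : A → A) {xs} → Unique xs →
  (∀ {x} → x ∈ xs → f x ∈ xs) → (∀ {x} → x ∈ xs → f (f x) ≡ x) → map f xs ↭ xs
involution-↭ f {xs} xs! f-closed f-inv = ∼bag⇒↭ (unique∧set⇒bag fxs! xs! (mk⇔ ⊆xs ⊇xs))
  where
  ff≡id : map f (map f xs) ≡ xs
  ff≡id = trans (sym (map-∘ xs)) (map-id-local (All.tabulate f-inv))
  fxs! : Unique (map f xs)
  fxs! = Unique.map⁻ (subst Unique (sym ff≡id) xs!)
  ⊆xs : ∀ {z} → z ∈ map f xs → z ∈ xs
  ⊆xs z∈ with ∈-map⁻ f z∈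
  ... | x , x∈ , refl = f-closed x∈
  ⊇xs : ∀ {z} → z ∈ xs → z ∈ map f xs
  ⊇xs {z} z∈ = subst (_∈ map f xs) (f-inv z∈) (∈-map⁺ f (f-closed z∈))

-- The band σ_{3m-2} and its reflection in the anti-diagonal

dec-! : ∀ n b r → r < suc n ∸ b → dec n b ! r ≡ n ∸ r
dec-! zero    zero    zero    _ = refl
dec-! zero    zero    (suc r) (s≤s ())
dec-! zero    (suc b) r       r< = ⊥-elim (n≮0 (subst (r <_) (0∸n≡0 b) r<))
dec-! (suc n) b       r       r< with b ≤? suc n
... | no  b≰ = ⊥-elim (n≮0 (subst (suc r ≤_) (m≤n⇒m∸n≡0 (≰⇒> b≰)) r<))
... | yes b≤ = trans (cong (_! r) (dec-suc n b b≤)) (unfolded r r<)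
  where
  unfolded : ∀ r → r < suc (suc n) ∸ b → (suc n ∷ dec n b) ! r ≡ suc n ∸ r
  unfolded zero    _  = refl
  unfolded (suc r) r< = dec-! n b r (≤-pred (subst (suc (suc r) ≤_) (+-∸-assoc 1 b≤) r<))

dec0-! : ∀ c r → (dec c 0 ++ [ 0 ]) ! r ≡ c ∸ r
dec0-! zero    zero          = refl
dec0-! zero    (suc zero)    = refl
dec0-! zero    (suc (suc r)) = refl
dec0-! (suc c) r             = trans (cong (λ l → (l ++ [ 0 ]) ! r) (dec-suc c 0 z≤n)) (unfolded r)
  where
  unfolded : ∀ r → ((suc c ∷ dec c 0) ++ [ 0 ]) ! r ≡ suc c ∸ r
  unfolded zero    = refl
  unfolded (suc r) = dec0-! c r

InBand : ℕ → Cell → Set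
InBand K (i , j) = i ≤ K × j ≤ K × K ≤ suc (i + j) × i + j ≤ suc K

∸≤⇒≤+ : ∀ m n {o} → m ∸ n ≤ o → m ≤ n + o
∸≤⇒≤+ m n m∸n≤o = ≤-trans (m≤n+m∸n m n) (+-monoʳ-≤ n m∸n≤o)

+-rearrange : ∀ a b c d → (a + b) + (c + d) ≡ (a + d) + (b + c)
+-rearrange = solve-∀

length-cellsFrom-∷ : ∀ i l u L M → length (cellsFrom i (l ∷ L) (u ∷ M)) ≡ (l ∸ u) + length (cellsFrom (suc i) L M)
length-cellsFrom-∷ i l u L M = trans (length-++ (map (i ,_) (range u l)))
  (cong (_+ length (cellsFrom (suc i) L M)) (trans (length-map (i ,_) (range u l)) (length-range u l)))

length-bandRows : ∀ i b → length (cellsFrom i (dec (3 + b) 2) (dec b 0 ++ [ 0 ])) ≡ 3 * b + 5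
length-bandRows i zero    = refl
length-bandRows i (suc b) = begin
  length (cellsFrom i (dec (4 + b) 2) (dec (suc b) 0 ++ [ 0 ]))
    ≡⟨ cong₂ (λ L M → length (cellsFrom i L (M ++ [ 0 ]))) (dec-suc (3 + b) 2 (s≤s (s≤s z≤n))) (dec-suc b 0 z≤n) ⟩
  length (cellsFrom i (4 + b ∷ dec (3 + b) 2) (suc b ∷ dec b 0 ++ [ 0 ]))
    ≡⟨ length-cellsFrom-∷ i (4 + b) (suc b) (dec (3 + b) 2) (dec b 0 ++ [ 0 ]) ⟩
  (4 + b ∸ suc b) + length (cellsFrom (suc i) (dec (3 + b) 2) (dec b 0 ++ [ 0 ]))
    ≡⟨ cong₂ _+_ (m+n∸n≡m 3 b) (length-bandRows (suc i) b) ⟩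
  3 + (3 * b + 5) ≡⟨ arith b ⟩
  3 * suc b + 5 ∎
  where
  open ≡-Reasoning
  arith : ∀ b → 3 + (3 * b + 5) ≡ 3 * suc b + 5
  arith = solve-∀

-- σ_{3m-2} for m = a + 3 is the band of cells with i, j ≤ K and K - 1 ≤ i + j ≤ K + 1, where K = a + 2.
module Band (a : ℕ) where

  K : ℕ
  K = 2 + a

  band : List Cell
  band = cells (σA (3 + a))

  private
    rows offsets : List ℕ
    rows    = 3 + a ∷ dec (3 + a) 2
    offsets = dec (suc a) 0 ++ [ 0 ]

    length-rows : length rows ≡ 3 + a
    length-rows = cong suc (length-dec (3 + a) 2)

  ∈-band⁻ : ∀ {i j} → (i , j) ∈ band → InBand K (i , j)
  ∈-band⁻ {i} {j} c∈ with ∈-cellsFrom⁻ 0 rows offsets c∈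
  ... | r , refl , r<L , offset≤j , j<row = ≤-pred r< , ≤-pred (j< r r< j<row) , K≤ , ≤1+K r r< j<row
    where
    r< = subst (r <_) length-rows r<L
    j< : ∀ r → r < 3 + a → j < rows ! r → j < 3 + a
    j< zero    _  j<row = j<row
    j< (suc r) r< j<row = ≤-trans (subst (j <_) (dec-! (3 + a) 2 r (≤-pred r<)) j<row) (m∸n≤m (3 + a) r)
    K≤ : K ≤ suc (r + j)
    K≤ = s≤s (∸≤⇒≤+ (suc a) r (subst (_≤ j) (dec0-! (suc a) r) offset≤j))
    ≤1+K : ∀ r → r < 3 + a → j < rows ! r → r + j ≤ 3 + a
    ≤1+K zero    _  j<row = <⇒≤ j<row
    ≤1+K (suc r) r< j<row = subst (_≤ 3 + a) (cong suc (+-comm j r))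
      (m≤o∸n⇒m+n≤o (suc j) (<⇒≤ (≤-pred (m≤n⇒m≤1+n r<))) (subst (j <_) (dec-! (3 + a) 2 r (≤-pred r<)) j<row))

  ∈-band⁺ : ∀ {i j} → InBand K (i , j) → (i , j) ∈ band
  ∈-band⁺ {i} {j} (i≤K , j≤K , K≤ , ≤1+K) = ∈-cellsFrom⁺ 0 rows offsets i i<L offset≤j (j<row i i≤K ≤1+K)
    where
    i<L = subst (i <_) (sym length-rows) (s≤s i≤K)
    offset≤j = subst (_≤ j) (sym (dec0-! (suc a) i)) (m≤n+o⇒m∸n≤o (suc a) i (≤-pred K≤))
    j<row : ∀ i → i ≤ K → i + j ≤ 3 + a → j < rows ! i
    j<row zero    _   _  = s≤s j≤K
    j<row (suc r) i≤K ≤1+K = subst (j <_) (sym (dec-! (3 + a) 2 r i≤K))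
      (m+n≤o⇒m≤o∸n (suc j) (subst (_≤ 3 + a) (cong suc (+-comm r j)) ≤1+K))

  reflect : Cell → Cell
  reflect (i , j) = (K ∸ j , K ∸ i)

  reflect-InBand : ∀ c → InBand K c → InBand K (reflect c)
  reflect-InBand (i , j) (i≤K , j≤K , K≤ , ≤1+K) = m∸n≤m K j , m∸n≤m K i , K≤′ , ≤1+K′
    where
    X = (K ∸ j) + (K ∸ i)
    X+i+j : X + (i + j) ≡ K + K
    X+i+j = trans (+-rearrange (K ∸ j) (K ∸ i) i j) (cong₂ _+_ (m∸n+n≡m j≤K) (m∸n+n≡m i≤K))
    K≤′ : K ≤ suc X
    K≤′ = +-cancelʳ-≤ K K (suc X) (subst (_≤ suc X + K) X+i+j
            (subst (X + (i + j) ≤_) (+-suc X K) (+-monoʳ-≤ X ≤1+K)))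
    ≤1+K′ : X ≤ suc K
    ≤1+K′ = +-cancelʳ-≤ K X (suc K) (subst (X + K ≤_) (cong suc X+i+j)
              (subst (X + K ≤_) (+-suc X (i + j)) (+-monoʳ-≤ X K≤)))

  reflect-involutive : ∀ c → InBand K c → reflect (reflect c) ≡ c
  reflect-involutive (i , j) (i≤K , j≤K , _) = cong₂ _,_ (m∸[m∸n]≡n i≤K) (m∸[m∸n]≡n j≤K)

  reflect-↭ : map reflect band ↭ band
  reflect-↭ = involution-↭ reflect (cellsFrom-unique 0 rows offsets)
    (λ c∈ → ∈-band⁺ (reflect-InBand _ (∈-band⁻ c∈)))
    (λ c∈ → reflect-involutive _ (∈-band⁻ c∈))

  ∸-≡ᵇ-∸ : ∀ {a b} → a ≤ K → b ≤ K → (K ∸ a ≡ᵇ K ∸ b) ≡ (a ≡ᵇ b)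
  ∸-≡ᵇ-∸ {a} {b} a≤K b≤K = trans (∸-≡ᵇ K a (K ∸ b) a≤K (m∸n≤m K b)) (cong (a ≡ᵇ_) (m∸[m∸n]≡n b≤K))

  reflect-≺ : ∀ c d → c ∈ band → d ∈ band → reflect c ≺ reflect d ≡ d ≺ c
  reflect-≺ (i , j) (i′ , j′) c∈ d∈
    with (i≤K , j≤K , _) ← ∈-band⁻ c∈ | (i′≤K , j′≤K , _) ← ∈-band⁻ d∈
    rewrite ∸-≡ᵇ-∸ j≤K j′≤K | ∸-≡ᵇ-∸ i≤K i′≤K | ∸-<ᵇ K i i′ i≤K | ∸-<ᵇ K j j′ j≤K
          | ≡ᵇ-sym i i′ | ≡ᵇ-sym j j′ = ∨-comm ((j′ ≡ᵇ j) ∧ (i′ <ᵇ i)) _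

  corner : Cell
  corner = (0 , K)

  reflect-≡ᶜ-corner : ∀ c → c ∈ band → (reflect c ≡ᶜ corner) ≡ (c ≡ᶜ corner)
  reflect-≡ᶜ-corner (i , j) c∈ with (i≤K , j≤K , _) ← ∈-band⁻ c∈ =
    trans (cong₂ _∧_ (∸-≡ᵇ K j 0 j≤K z≤n) (trans (∸-≡ᵇ K i K i≤K ≤-refl) (cong (i ≡ᵇ_) (n∸n≡0 K))))
          (∧-comm (j ≡ᵇ K) (i ≡ᵇ 0))

  private
    rest : List Cell
    rest = cellsFrom 1 (dec (3 + a) 2) (dec a 0 ++ [ 0 ])

    band-≡ : band ≡ (0 , suc a) ∷ (0 , K) ∷ rest
    band-≡ = trans (cong (λ os → cellsFrom 0 rows (os ++ [ 0 ])) (dec-suc a 0 z≤n))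
      (cong (λ r → map (0 ,_) r ++ rest) first-row)
      where
      first-row : range (suc a) (3 + a) ≡ suc a ∷ K ∷ []
      first-row = trans (cong (λ n → map (suc a +_) (upTo n)) (m+n∸n≡m 2 a))
        (cong₂ (λ x y → x ∷ y ∷ []) (+-identityʳ (suc a)) (+-comm (suc a) 1))

  corner-simple : multiplicity corner band ≡ 1
  corner-simple rewrite band-≡ | ≡ᵇ-false a (suc a) (1+n≢n ∘ sym) | ≡ᵇ-refl a =
    cong suc (∑-zero rest (λ c c∈ → cong 𝟙 (not-row₀ c c∈)))
    where
    not-row₀ : ∀ c → c ∈ rest → (c ≡ᶜ corner) ≡ false
    not-row₀ (suc i , j) _  = refl
    not-row₀ (zero , j)  c∈ with () ← proj₁ (cellsFrom-rows 1 (dec (3 + a) 2) (dec a 0 ++ [ 0 ]) c∈)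

  length-band : length band ≡ 3 * a + 7
  length-band = trans (cong length band-≡) (trans (cong (2 +_) (length-bandRows 1 a)) (arith a))
    where
    arith : ∀ a → 2 + (3 * a + 5) ≡ 3 * a + 7
    arith = solve-∀

-- The shapes σ_{3m-1}, σ_{3m} and τ_{3m} in terms of smaller ones

module Shapes (a : ℕ) where

  open Band a public

  m : ℕ
  m = 3 + a

  cellsB : List Cell
  cellsB = cells (σB m)

  private
    rowsP offsetsP : List ℕ
    rowsP    = m ∷ m ∷ dec m 3
    offsetsP = dec (2 + a) 0
    P : List Cell
    P        = cellsFrom 0 rowsP offsetsP

    length-rowsP : length rowsP ≡ m
    length-rowsP = cong (λ n → suc (suc n)) (length-dec m 3)

    length-offsetsP : length offsetsP ≡ m
    length-offsetsP = length-dec (2 + a) 0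

    rowsP≡offsetsP : length rowsP ≡ length offsetsP
    rowsP≡offsetsP = trans length-rowsP (sym length-offsetsP)

    P-rows : ∀ {c} → c ∈ P → proj₁ c < m
    P-rows {c} c∈ = subst (proj₁ c <_) length-rowsP (proj₂ (cellsFrom-rows 0 rowsP offsetsP c∈))

  cellsB-down : cellsB ≡ corner ∷ map down band
  cellsB-down = trans (cong (λ os → cellsFrom 0 (m ∷ m ∷ dec m 2) (os ++ [ 0 ])) (dec-suc (suc a) 0 z≤n))
    (cong₂ _++_ row₀ (cellsFrom-suc 0 (m ∷ dec m 2) (dec (suc a) 0 ++ [ 0 ])))
    where
    row₀ : map (0 ,_) (range K m) ≡ corner ∷ []
    row₀ = cong (map (0 ,_)) (trans (cong (λ n → map (K +_) (upTo n)) (m+n∸n≡m 1 a)) (cong [_] (+-identityʳ K)))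

  cellsB-∷ʳ : cellsB ≡ P ++ (m , 0) ∷ (m , 1) ∷ []
  cellsB-∷ʳ = trans (cong (λ L → cellsFrom 0 (m ∷ m ∷ L) (offsetsP ++ [ 0 ])) (dec-∷ʳ m 2 (s≤s (s≤s z≤n))))
    (trans (cellsFrom-∷ʳ 0 rowsP offsetsP 2 0 rowsP≡offsetsP)
      (cong (λ r → P ++ map (r ,_) (range 0 2)) length-rowsP))

  σC-cells : cells (σC m) ≡ cellsB ++ [ (suc m , 0) ]
  σC-cells = trans (cong₂ (λ L M → cellsFrom 0 (m ∷ m ∷ L) M) (dec-∷ʳ m 1 (s≤s z≤n)) (sym (++-assoc offsetsP [ 0 ] [ 0 ])))
    (trans (cellsFrom-∷ʳ 0 (m ∷ m ∷ dec m 2) (offsetsP ++ [ 0 ]) 1 0 lengths)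
      (cong (λ r → cellsB ++ map (r ,_) (range 0 1)) length-rowsB))
    where
    length-rowsB : length (m ∷ m ∷ dec m 2) ≡ suc m
    length-rowsB = cong (λ n → suc (suc n)) (length-dec m 2)
    lengths : length (m ∷ m ∷ dec m 2) ≡ length (offsetsP ++ [ 0 ])
    lengths = trans length-rowsB (sym (trans (length-++ offsetsP) (trans (cong (_+ 1) length-offsetsP) (+-comm m 1))))

  τ-cells : cells (τ m) ≡ map right P ++ (m , 0) ∷ (m , 1) ∷ (m , 2) ∷ []
  τ-cells = trans (cong₂ (λ L M → cellsFrom 0 (suc m ∷ suc m ∷ L) M) rowsτ offsetsτ)
    (trans (cellsFrom-∷ʳ 0 (map suc rowsP) (map suc offsetsP) 3 0 lengths)
      (cong₂ (λ X r → X ++ map (r ,_) (range 0 3)) (cellsFrom-map-suc 0 rowsP offsetsP rowsP≡offsetsP)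
         (trans (length-map suc rowsP) length-rowsP)))
    where
    rowsτ : dec (suc m) 3 ≡ map suc (dec m 3) ++ [ 3 ]
    rowsτ = trans (dec-map-suc m 2) (trans (cong (map suc) (dec-∷ʳ m 2 (s≤s (s≤s z≤n)))) (map-++ suc (dec m 3) [ 2 ]))
    offsetsτ : dec m 0 ≡ map suc offsetsP ++ [ 0 ]
    offsetsτ = trans (dec-∷ʳ m 0 z≤n) (cong (_++ [ 0 ]) (dec-map-suc (2 + a) 0))
    lengths : length (map suc rowsP) ≡ length (map suc offsetsP)
    lengths = trans (length-map suc rowsP) (trans rowsP≡offsetsP (sym (length-map suc offsetsP)))

  τ-↭ : cells (τ m) ↭ (m , 0) ∷ map right cellsB
  τ-↭ = subst (cells (τ m) ↭_) (cong ((m , 0) ∷_) (sym (trans (cong (map right) cellsB-∷ʳ) (map-++ right P _))))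
    (subst (_↭ (m , 0) ∷ map right P ++ (m , 1) ∷ (m , 2) ∷ []) (sym τ-cells) (↭.shift (m , 0) (map right P) _))

  cellsB-rows : ∀ {c} → c ∈ cellsB → proj₁ c ≤ m
  cellsB-rows {c} c∈ with ∈-++⁻ P (subst (c ∈_) cellsB-∷ʳ c∈)
  ... | inj₁ c∈P                = <⇒≤ (P-rows c∈P)
  ... | inj₂ (here refl)        = ≤-refl
  ... | inj₂ (there (here refl)) = ≤-refl

  bottom-simple : multiplicity (m , 0) cellsB ≡ 1
  bottom-simple rewrite cellsB-∷ʳ | ∑-++ P ((m , 0) ∷ (m , 1) ∷ []) (λ c → 𝟙 (c ≡ᶜ (m , 0))) | ≡ᵇ-refl a =
    cong (_+ 1) (∑-zero P (λ { (i , j) c∈ → cong (λ b → 𝟙 (b ∧ (j ≡ᵇ 0))) (≡ᵇ-false i m (<⇒≢ (P-rows c∈))) }))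

  corner-before : JustBefore corner (down corner) (map down band)
  corner-before = record
    { nothing-before = λ c c∈ → case ∈-map⁻ down c∈ of λ { ((i , j) , _ , refl) → ∧-zeroʳ (j ≡ᵇ K) }
    ; only-via-w     = via
    ; x≺w            = cong (λ b → b ∧ true) (≡ᵇ-refl K)
    ; w-simple       = trans (multiplicity-map down band corner (λ c → down-≡ᶜ c corner)) corner-simple
    }
    where
    via : ∀ c → c ∈ map down band → corner ≺ c ≡ true → c ≡ down corner ⊎ down corner ≺ c ≡ true
    via c c∈ K≡j with ∈-map⁻ down c∈
    ... | (zero  , j) , _ , refl rewrite ≡ᵇ-true⁻ K j (trans (sym (∧-identityʳ _)) K≡j) = inj₁ refl
    ... | (suc i , j) , _ , refl rewrite ≡ᵇ-true⁻ K j (trans (sym (∧-identityʳ _)) K≡j) = inj₂ (cong (_∧ true) (≡ᵇ-refl j))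

  bottom-after : JustAfter (suc m , 0) (m , 0) cellsB
  bottom-after = record
    { nothing-after = λ { (i , j) c∈ → below-last i j (cellsB-rows c∈) }
    ; only-via-u    = via
    ; u≺z           = trans (cong ((m ≡ᵇ suc m) ∧ false ∨_) (<ᵇ-true m (suc m) ≤-refl)) (∨-zeroʳ _)
    ; u-simple      = bottom-simple
    }
    where
    below-last : ∀ i j → i ≤ m → (suc m , 0) ≺ (i , j) ≡ false
    below-last i j i≤m rewrite ≡ᵇ-false (suc m) i (<⇒≢ (s≤s i≤m) ∘ sym) | <ᵇ-false (suc m) i (m≤n⇒m≤1+n i≤m) = ∧-zeroʳ (0 ≡ᵇ j)
    via : ∀ c → c ∈ cellsB → c ≺ (suc m , 0) ≡ true → c ≡ (m , 0) ⊎ c ≺ (m , 0) ≡ true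
    via (i , j) c∈ c≺ rewrite ≡ᵇ-false i (suc m) (<⇒≢ (s≤s (cellsB-rows c∈))) with j | c≺
    ... | zero | _ with i ≟ m
    ...   | yes refl = inj₁ refl
    ...   | no  i≢m  = inj₂ (trans (cong ((i ≡ᵇ m) ∧ false ∨_) (<ᵇ-true i m (≤∧≢⇒< (cellsB-rows c∈) i≢m))) (∨-zeroʳ _))

  bottom-before : JustBefore (m , 0) (right (m , 0)) (map right cellsB)
  bottom-before = record
    { nothing-before = λ c c∈ → case ∈-map⁻ right c∈ of λ { ((i , j) , _ , refl) → trans (∨-identityʳ _) (∧-zeroʳ (i ≡ᵇ m)) }
    ; only-via-w     = via
    ; x≺w            = cong (λ b → b ∧ true ∨ false) (≡ᵇ-refl a)
    ; w-simple       = trans (multiplicity-map right cellsB (m , 0) (λ c → right-≡ᶜ c (m , 0))) bottom-simple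
    }
    where
    via : ∀ c → c ∈ map right cellsB → (m , 0) ≺ c ≡ true → c ≡ right (m , 0) ⊎ right (m , 0) ≺ c ≡ true
    via c c∈ m≡i with ∈-map⁻ right c∈
    ... | (i , zero)  , _ , refl rewrite ≡ᵇ-true⁻ m i (trans (sym (trans (∨-identityʳ _) (∧-identityʳ _))) m≡i) = inj₁ refl
    ... | (i , suc j) , _ , refl rewrite ≡ᵇ-true⁻ m i (trans (sym (trans (∨-identityʳ _) (∧-identityʳ _))) m≡i) =
      inj₂ (cong (λ b → b ∧ true ∨ false) (≡ᵇ-refl i))

  NA LB : ℕ
  NA = length band
  LB = length cellsB

  length-cellsB : LB ≡ suc NA
  length-cellsB = trans (cong length cellsB-down) (cong suc (length-map down band))

  3m≡2+NA : 3 * m ≡ 2 + NA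
  3m≡2+NA = trans (arith a) (cong (2 +_) (sym length-band))
    where
    arith : ∀ a → 3 * (3 + a) ≡ 2 + (3 * a + 7)
    arith = solve-∀

  3m≡1+LB : 3 * m ≡ suc LB
  3m≡1+LB = trans 3m≡2+NA (cong suc (sym length-cellsB))

  σB-count : f (σB m) ≡ ∑ (allFillings band NA) (onSYT NA (entry corner))
  σB-count = begin
    #SYT cellsB LB                                      ≡⟨ cong (λ cs → #SYT cs (length cs)) cellsB-down ⟩
    #SYT (corner ∷ map down band) (suc (length (map down band)))
                                                        ≡⟨ cong (λ n → #SYT (corner ∷ map down band) (suc n)) (length-map down band) ⟩
    #SYT (corner ∷ map down band) (suc NA)              ≡⟨ #SYT-JustBefore NA corner-before ⟩
    ∑ (allFillings (map down band) NA) (onSYT NA (entry (down corner)))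
                                                        ≡⟨ ∑-entry-relabel down band NA corner down-≺ (λ c → down-≡ᶜ c corner) ⟩
    ∑ (allFillings band NA) (onSYT NA (entry corner))   ∎
    where open ≡-Reasoning

  σC-count : f (σC m) ≡ ∑ (allFillings cellsB LB) (onSYT LB (λ T → suc LB ∸ entry (m , 0) T))
  σC-count = begin
    f (σC m)                                          ≡⟨ cong (λ cs → #SYT cs (length cs)) σC-cells ⟩
    #SYT (cellsB ++ [ z ]) (length (cellsB ++ [ z ])) ≡⟨ cong (#SYT (cellsB ++ [ z ])) (trans (length-++ cellsB) (+-comm LB 1)) ⟩
    #SYT (cellsB ++ [ z ]) (suc LB)                   ≡⟨ #SYT-↭ (suc LB) (↭.∷↭∷ʳ z cellsB) ⟨
    #SYT (z ∷ cellsB) (suc LB)                        ≡⟨ #SYT-JustAfter LB bottom-after ⟩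
    ∑ (allFillings cellsB LB) (onSYT LB (λ T → suc LB ∸ entry (m , 0) T)) ∎
    where
    open ≡-Reasoning
    z : Cell
    z = (suc m , 0)

  τ-count : f (τ m) ≡ ∑ (allFillings cellsB LB) (onSYT LB (entry (m , 0)))
  τ-count = begin
    f (τ m)                                       ≡⟨ cong (#SYT (cells (τ m))) (trans (↭.↭-length τ-↭) (cong suc (length-map right cellsB))) ⟩
    #SYT (cells (τ m)) (suc LB)                   ≡⟨ #SYT-↭ (suc LB) τ-↭ ⟩
    #SYT ((m , 0) ∷ map right cellsB) (suc LB)    ≡⟨ #SYT-JustBefore LB bottom-before ⟩
    ∑ (allFillings (map right cellsB) LB) (onSYT LB (entry (right (m , 0))))
                                                  ≡⟨ ∑-entry-relabel right cellsB LB (m , 0) right-≺ (λ c → right-≡ᶜ c (m , 0)) ⟩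
    ∑ (allFillings cellsB LB) (onSYT LB (entry (m , 0))) ∎
    where open ≡-Reasoning

  σA-σB : (3 * m ∸ 1) * f (σA m) ≡ 2 * f (σB m)
  σA-σB = begin
    (3 * m ∸ 1) * #SYT band NA  ≡⟨ cong (λ n → (n ∸ 1) * #SYT band NA) 3m≡2+NA ⟩
    suc NA * #SYT band NA       ≡⟨ ∑-entry+complement band NA corner corner-simple ⟨
    S + ∑ (allFillings band NA) (onSYT NA (λ T → suc NA ∸ entry corner T))
      ≡⟨ cong (S +_) (∑-entry-antiautomorphism reflect band NA corner reflect-↭ reflect-≺ reflect-≡ᶜ-corner corner-simple) ⟨
    S + S                       ≡⟨ cong (S +_) (+-identityʳ S) ⟨
    2 * S                       ≡⟨ cong (2 *_) σB-count ⟨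
    2 * f (σB m)                ∎
    where
    open ≡-Reasoning
    S : ℕ
    S = ∑ (allFillings band NA) (onSYT NA (entry corner))

  σB-σC-τ : (3 * m) * f (σB m) ≡ f (σC m) + f (τ m)
  σB-σC-τ = begin
    (3 * m) * #SYT cellsB LB  ≡⟨ cong (_* #SYT cellsB LB) 3m≡1+LB ⟩
    suc LB * #SYT cellsB LB   ≡⟨ ∑-entry+complement cellsB LB (m , 0) bottom-simple ⟨
    Sₑ + Sᶜ                   ≡⟨ +-comm Sₑ Sᶜ ⟩
    Sᶜ + Sₑ                   ≡⟨ cong₂ _+_ σC-count τ-count ⟨
    f (σC m) + f (τ m)        ∎
    where
    open ≡-Reasoning
    Sₑ Sᶜ : ℕ
    Sₑ = ∑ (allFillings cellsB LB) (onSYT LB (entry (m , 0)))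
    Sᶜ = ∑ (allFillings cellsB LB) (onSYT LB (λ T → suc LB ∸ entry (m , 0) T))

lemma2p1 : (n : ℕ) → 1 ≤ n →
    ((3 * n ∸ 1) * f (σA n) ≡ 2 * f (σB n))
      × ((3 * n) * f (σB n) ≡ f (σC n) + f (τ n))
lemma2p1 1                   _ = refl , refl
lemma2p1 2                   _ = refl , refl
lemma2p1 (suc (suc (suc a))) _ = σA-σB , σB-σC-τ
  where open Shapes a
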